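{- Let $\varepsilon\in(0,1)$ and let $G=(V,E)$ be a graph on $n$ vertices with arboricity at most $\alpha$. Let $\theta=4\alpha\lceil\log n\rceil/\varepsilon$, $\ell=\lceil\log n\rceil$ and $\rho=n\theta(\ell+1)$. Then the procedure Sample-edge$(G,\alpha,\varepsilon)$ returns each (ordered) edge $(v,w)$ of $G$ with probability in the range $\left[\frac{1-\varepsilon/2}{\rho},\frac{1}{\rho}\right]$.
   Context: $d(v)$ denotes degree; each undirected edge $\{v,w\}$ is viewed as the two ordered edges $(v,w),(w,v)$. The arboricity of $G$ is the minimum number of spanning forests whose edge sets cover $E$. Procedure Sample-a-leaf$(G,\theta)$: sample $u\in V$ uniformly and query its degree; if $d(u)>\theta$ return FAIL; else return $u$ with probability $d(u)/\theta$ and FAIL otherwise. Procedure Random-walk$(G,\theta,j)$: invoke Sample-a-leaf$(G,\theta)$, letting $v_0$ be its output (return FAIL if it fails); for $i=1,\dots,j$ sample a uniformly random neighbor $v_i$ of $v_{i-1}$ and return FAIL if $d(v_i)\le\theta$; finally return $v_j$. Procedure Sample-edge$(G,\alpha,\varepsilon)$: set $\theta=4\alpha\lceil\log n\rceil/\varepsilon$ and $\ell=\lceil\log n\rceil$; choose $j\in\{0,\dots,\ell\}$ uniformly at random; invoke Random-walk$(G,\theta,j)$, and if it returns FAIL return FAIL, else let $v$ be the returned vertex; sample a uniform neighbor $w$ of $v$ and return $e=(v,w)$.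
   Formalization: The parameter ε ranges over the rationals in $(0,1)$, with log taken to base 2. -}

module Defs where

open import Data.Bool using (Bool; true; false; if_then_else_)
open import Data.Nat using (ℕ; zero; suc; _≤_)
open import Data.Nat.Logarithm using (⌈log₂_⌉)
open import Data.Fin using (Fin)
import Data.Fin.Properties as FinP
open import Data.Integer using (+_)
open import Data.Rational using (ℚ; 0ℚ; 1ℚ; _+_; _*_; _-_; _/_; _÷_; _<_; ≢-nonZero)
import Data.Rational.Properties as ℚP
open import Data.List using (List; []; _∷_; _++_; [_]; length; map; filter; foldr; concatMap; upTo; allFin)
open import Data.List.Relation.Unary.Unique.Propositional using (Unique)
open import Data.List.Relation.Unary.Linked using (Linked)
open import Data.Maybe using (Maybe; just; nothing)
import Data.Maybe.Properties as MaybeP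
open import Data.Product using (_×_; _,_; Σ; ∃; proj₁; proj₂)
import Data.Product.Properties as ProdP
open import Relation.Binary.PropositionalEquality using (_≡_)
open import Relation.Binary.Definitions using (DecidableEquality)
open import Relation.Nullary using (yes; no; does)
open import Relation.Nullary.Decidable using (⌊_⌋)

record Graph (n : ℕ) : Set where
  field
    adj     : Fin n → Fin n → Bool
    symm    : ∀ v w → adj v w ≡ adj w v
    irrefl  : ∀ v → adj v v ≡ false
open Graph public

IsEdge : ∀ {n} → Graph n → Fin n → Fin n → Set
IsEdge G v w = adj G v w ≡ true

nbrs : ∀ {n} → Graph n → Fin n → List (Fin n)
nbrs {n} G v = filter (λ w → adj G v w Data.Bool.≟ true) (allFin n)
  where import Data.Bool

deg : ∀ {n} → Graph n → Fin n → ℕ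
deg G v = length (nbrs G v)

EdgeSubset : ∀ {n} → Graph n → Set
EdgeSubset {n} G = Σ (Fin n → Fin n → Bool) λ F →
  (∀ v w → F v w ≡ F w v) × (∀ v w → F v w ≡ true → adj G v w ≡ true)

HasCycle : ∀ {n} → (Fin n → Fin n → Bool) → Set
HasCycle {n} F = Σ (Fin n) λ x → Σ (List (Fin n)) λ xs →
  (2 ≤ length xs) × Unique (x ∷ xs) ×
  Linked (λ a b → F a b ≡ true) (x ∷ xs ++ [ x ])

IsForest : ∀ {n} {G : Graph n} → EdgeSubset G → Set
IsForest F = HasCycle (proj₁ F) → Data.Empty.⊥
  where import Data.Empty

ArboricityAtMost : ∀ {n} → Graph n → ℕ → Set
ArboricityAtMost {n} G α = Σ (Fin α → EdgeSubset G) λ Fs →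
  (∀ i → IsForest {G = G} (Fs i)) ×
  (∀ v w → adj G v w ≡ true → ∃ λ i → proj₁ (Fs i) v w ≡ true)

-- Finite probability distributions with rational weights
-- (a sub-distribution is a list of outcome/weight pairs)

Dist : Set → Set
Dist A = List (A × ℚ)

ret : ∀ {A} → A → Dist A
ret a = [ (a , 1ℚ) ]

_>>=_ : ∀ {A B} → Dist A → (A → Dist B) → Dist B
d >>= f = concatMap (λ p → map (λ q → (proj₁ q , proj₂ p * proj₂ q)) (f (proj₁ p))) d

uniform : ∀ {A} → List A → Dist A
uniform []       = []
uniform (x ∷ xs) = map (λ y → (y , (+ 1) / length (x ∷ xs))) (x ∷ xs)

coin : ℚ → Dist Bool
coin p = (true , p) ∷ (false , 1ℚ - p) ∷ []

Pr : ∀ {A} → DecidableEquality A → Dist A → A → ℚ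
Pr _≟_ d a = foldr (λ p s → (if does (proj₁ p ≟ a) then proj₂ p else 0ℚ) + s) 0ℚ d

-- division on ℚ, with the (never used) convention p / 0 = 0
_÷₀_ : ℚ → ℚ → ℚ
p ÷₀ q with q ℚP.≟ 0ℚ
... | yes _ = 0ℚ
... | no q≢0 = _÷_ p q {{≢-nonZero q≢0}}

ℕ→ℚ : ℕ → ℚ
ℕ→ℚ k = (+ k) / 1

-- The procedures (FAIL is represented by nothing)

module Procedures {n : ℕ} (G : Graph n) where

  fail : ∀ {A} → Dist (Maybe A)
  fail = ret nothing

  heavy : ℚ → Fin n → Bool
  heavy θ u = ⌊ θ ℚP.<? ℕ→ℚ (deg G u) ⌋

  sampleALeaf : ℚ → Dist (Maybe (Fin n))
  sampleALeaf θ =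
    uniform (allFin n) >>= λ u →
      if heavy θ u then fail
      else (coin (ℕ→ℚ (deg G u) ÷₀ θ) >>= λ b →
              if b then ret (just u) else fail)

  walk : ℚ → ℕ → Fin n → Dist (Maybe (Fin n))
  walk θ zero    v = ret (just v)
  walk θ (suc i) v =
    uniform (nbrs G v) >>= λ w →
      if heavy θ w then walk θ i w else fail

  randomWalk : ℚ → ℕ → Dist (Maybe (Fin n))
  randomWalk θ j = sampleALeaf θ >>= λ
    { nothing   → fail
    ; (just v₀) → walk θ j v₀ }

  θ-of : ℕ → ℚ → ℚ
  θ-of α ε = (ℕ→ℚ (4 Data.Nat.* α Data.Nat.* ⌈log₂ n ⌉)) ÷₀ ε
    where import Data.Nat

  ℓ-of : ℕ
  ℓ-of = ⌈log₂ n ⌉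

  sampleEdge : ℕ → ℚ → Dist (Maybe (Fin n × Fin n))
  sampleEdge α ε =
    uniform (upTo (suc ℓ-of)) >>= λ j →
      randomWalk (θ-of α ε) j >>= λ
        { nothing  → fail
        ; (just v) → uniform (nbrs G v) >>= λ w → ret (just (v , w)) }

outcome-≟ : ∀ {n} → DecidableEquality (Maybe (Fin n × Fin n))
outcome-≟ = MaybeP.≡-dec (ProdP.≡-dec FinP._≟_ FinP._≟_)

PrSampleEdge : ∀ {n} → Graph n → ℕ → ℚ → Fin n → Fin n → ℚ
PrSampleEdge G α ε v w =
  Pr outcome-≟ (Procedures.sampleEdge G α ε) (just (v , w))

module Submission where

-- Pr[(v, w)] = r(v) / ((ℓ + 1) d(v)), where r(v) = Σ_{j ≤ ℓ} Pr[the j-step walk returns v].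
-- The scaled masses m_k(x) = nθ Σ_{j < k} Pr[the j-step walk returns x] satisfy
-- m_{k+1}(x) = d(x) for light x and m_{k+1}(x) = Σ_{y ∼ x} m_k(y) / d(y) for heavy x,
-- so m_k ≤ d, which is the upper bound.  For the lower bound, orient each of the α forests
-- so that every vertex has at most one parent in it.  For heavy x and a heavy neighbour y,
-- either y is a parent of x (there are at most α ≤ (α/θ) d(x) such y) or x is a parent
-- of y, and then the deficit of y is passed on to x.  Induction on k gives
-- m_{k+1}(x) / d(x) ≥ 1 − kα/θ − C_k(x) for heavy x, where C_k(x) ≤ n (α/θ)^k;
-- for k = ℓ = ⌈log n⌉ and θ = 4αℓ/ε both error terms are at most ε/4.

open import Defs
open import Algebra.Bundles using (CommutativeRing)
open import Data.Bool using (Bool; true; false; if_then_else_; T)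
import Data.Bool as Bool
import Data.Bool.Properties as BoolP
open import Data.Empty using (⊥-elim)
open import Data.Fin using (Fin; zero; suc; toℕ; fromℕ<)
import Data.Fin.Properties as FinP
open import Data.Fin.Subset as Subset using (Subset; _∈_; ∣_∣; ⊤)
import Data.Fin.Subset.Properties as SubsetP
import Data.Integer as ℤ
import Data.Integer.Properties as ℤP
open import Data.List using (List; []; _∷_; _++_; [_]; map; length; filter; allFin; tabulate; applyUpTo; upTo)
import Data.List.Properties as ListP
open import Data.List.Relation.Unary.All using (All; []; _∷_)
open import Data.List.Relation.Unary.AllPairs using ([]; _∷_)
open import Data.List.Relation.Unary.Linked using (Linked; [-]; _∷_)
open import Data.List.Relation.Unary.Unique.Propositional using (Unique)
open import Data.Maybe using (Maybe; just; nothing)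
import Data.Maybe.Properties as MaybeP
open import Data.Nat as ℕ using (ℕ; zero; suc; ⌊_/2⌋; ⌈_/2⌉)
import Data.Nat.Coprimality as Coprime
open import Data.Nat.Induction using (<-wellFounded)
open import Data.Nat.Logarithm using (⌈log₂_⌉)
open import Data.Nat.Logarithm.Core using (⌈log2⌉)
import Data.Nat.Properties as ℕP
open import Data.Product using (_×_; _,_; proj₁; proj₂; ∃; ∃₂)
open import Data.Rational using (ℚ; mkℚ; 0ℚ; 1ℚ; ½; _+_; _*_; -_; _-_; _/_; 1/_; _<_; _≤_; *≤*; *<*; NonZero; ≢-nonZero; nonNegative; positive)
import Data.Rational.Properties as ℚP
open import Data.Rational.Solver
open +-*-Solver
open import Data.Sum using (_⊎_; inj₁; inj₂)
import Data.Sum as Sum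
open import Data.Unit using (tt)
open import Function using (_∘_)
open import Induction.WellFounded using (Acc; acc)
open import Relation.Binary.Definitions using (DecidableEquality)
open import Relation.Binary.PropositionalEquality hiding ([_])
open import Relation.Nullary using (yes; no; does; ¬_; Dec; contradiction)
import Relation.Nullary.Decidable as Dec
open import Relation.Unary using (Decidable)
open import Algebra.Properties.Semiring.Sum (CommutativeRing.semiring ℚP.+-*-commutativeRing)
open import Algebra.Properties.CommutativeSemiring.Exp (CommutativeRing.commutativeSemiring ℚP.+-*-commutativeRing)
  using (_^_; ^-distrib-*)

ℕ→ℚ≡mkℚ : ∀ k → ℕ→ℚ k ≡ mkℚ (ℤ.+ k) 0 (Coprime.sym (Coprime.1-coprimeTo k))
ℕ→ℚ≡mkℚ k = ℚP.↥p/↧p≡p _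

ℕ→ℚ-+ : ∀ a b → ℕ→ℚ (a ℕ.+ b) ≡ ℕ→ℚ a + ℕ→ℚ b
ℕ→ℚ-+ a b rewrite ℕ→ℚ≡mkℚ a | ℕ→ℚ≡mkℚ b =
  ℚP./-cong (cong₂ ℤ._+_ (sym (ℤP.*-identityʳ (ℤ.+ a))) (sym (ℤP.*-identityʳ (ℤ.+ b)))) refl

ℕ→ℚ-* : ∀ a b → ℕ→ℚ (a ℕ.* b) ≡ ℕ→ℚ a * ℕ→ℚ b
ℕ→ℚ-* a b rewrite ℕ→ℚ≡mkℚ a | ℕ→ℚ≡mkℚ b = ℚP./-cong (ℤP.pos-* a b) refl

ℕ→ℚ-suc : ∀ k → ℕ→ℚ (suc k) ≡ 1ℚ + ℕ→ℚ k
ℕ→ℚ-suc = ℕ→ℚ-+ 1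

ℕ→ℚ-mono-≤ : ∀ {a b} → a ℕ.≤ b → ℕ→ℚ a ≤ ℕ→ℚ b
ℕ→ℚ-mono-≤ {a} {b} a≤b rewrite ℕ→ℚ≡mkℚ a | ℕ→ℚ≡mkℚ b =
  *≤* (subst₂ ℤ._≤_ (sym (ℤP.*-identityʳ (ℤ.+ a))) (sym (ℤP.*-identityʳ (ℤ.+ b))) (ℤ.+≤+ a≤b))

ℕ→ℚ-cancel-< : ∀ {a b} → ℕ→ℚ a < ℕ→ℚ b → a ℕ.< b
ℕ→ℚ-cancel-< {a} {b} a<b rewrite ℕ→ℚ≡mkℚ a | ℕ→ℚ≡mkℚ b =
  ℤP.drop‿+<+ (subst₂ ℤ._<_ (ℤP.*-identityʳ (ℤ.+ a)) (ℤP.*-identityʳ (ℤ.+ b)) (ℚP.drop-*<* a<b))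

ℕ→ℚ-nonNeg : ∀ k → 0ℚ ≤ ℕ→ℚ k
ℕ→ℚ-nonNeg k = ℕ→ℚ-mono-≤ {0} {k} ℕ.z≤n

ℕ→ℚ-suc-pos : ∀ k → 0ℚ < ℕ→ℚ (suc k)
ℕ→ℚ-suc-pos k rewrite ℕ→ℚ≡mkℚ (suc k) = *<* (ℤ.+<+ (ℕ.s≤s ℕ.z≤n))

inv : ℚ → ℚ
inv q = 1ℚ ÷₀ q

÷₀≡*inv : ∀ p q → p ÷₀ q ≡ p * inv q
÷₀≡*inv p q with q ℚP.≟ 0ℚ
... | yes _ = sym (ℚP.*-zeroʳ p)
... | no _  = cong (p *_) (sym (ℚP.*-identityˡ _))

inv-inverseʳ : ∀ {q} → q ≢ 0ℚ → q * inv q ≡ 1ℚ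
inv-inverseʳ {q} q≢0 with q ℚP.≟ 0ℚ
... | yes q≡0 = contradiction q≡0 q≢0
... | no q≢0′ = trans (cong (q *_) (ℚP.*-identityˡ _)) (ℚP.*-inverseʳ q {{≢-nonZero q≢0′}})

1/-nonNeg : ∀ p .{{_ : NonZero p}} → 0ℚ ≤ p → 0ℚ ≤ 1/ p
1/-nonNeg (mkℚ ℤ.+[1+ _ ] _ _) _ = ℚP.nonNegative⁻¹ _
1/-nonNeg p@(mkℚ ℤ.-[1+ _ ] _ _) 0≤p = contradiction (ℚP.<-≤-trans (ℚP.negative⁻¹ p) 0≤p) (ℚP.<-irrefl refl)

inv-nonNeg : ∀ {q} → 0ℚ ≤ q → 0ℚ ≤ inv q
inv-nonNeg {q} 0≤q with q ℚP.≟ 0ℚ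
... | yes _ = ℚP.≤-refl
... | no q≢0 = subst (0ℚ ≤_) (sym (ℚP.*-identityˡ _)) (1/-nonNeg q {{≢-nonZero q≢0}} 0≤q)

*-monoʳ-≤-nonNeg : ∀ {p q} r → 0ℚ ≤ r → p ≤ q → p * r ≤ q * r
*-monoʳ-≤-nonNeg r 0≤r = ℚP.*-monoʳ-≤-nonNeg r {{nonNegative 0≤r}}

*-monoˡ-≤-nonNeg : ∀ {p q} r → 0ℚ ≤ r → p ≤ q → r * p ≤ r * q
*-monoˡ-≤-nonNeg r 0≤r = ℚP.*-monoˡ-≤-nonNeg r {{nonNegative 0≤r}}

*-nonNeg : ∀ {p q} → 0ℚ ≤ p → 0ℚ ≤ q → 0ℚ ≤ p * q
*-nonNeg {p} {q} 0≤p 0≤q = subst (_≤ p * q) (ℚP.*-zeroʳ p) (*-monoˡ-≤-nonNeg p 0≤p 0≤q)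

+-nonNeg : ∀ {p q} → 0ℚ ≤ p → 0ℚ ≤ q → 0ℚ ≤ p + q
+-nonNeg = ℚP.+-mono-≤

0≤1 : 0ℚ ≤ 1ℚ
0≤1 = ℚP.nonNegative⁻¹ 1ℚ

p≤p+q : ∀ {p q} → 0ℚ ≤ q → p ≤ p + q
p≤p+q {p} 0≤q = subst (_≤ p + _) (ℚP.+-identityʳ p) (ℚP.+-monoʳ-≤ p 0≤q)

p≤q+p : ∀ {p q} → 0ℚ ≤ q → p ≤ q + p
p≤q+p {p} {q} 0≤q = subst (p ≤_) (ℚP.+-comm p q) (p≤p+q 0≤q)

p-q≤p : ∀ {p q} → 0ℚ ≤ q → p - q ≤ p
p-q≤p {p} {q} 0≤q = subst (p - q ≤_) (solve 2 (λ p q → p :- q :+ q := p) refl p q) (p≤p+q 0≤q)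

+-cancelʳ-≤ : ∀ {p q} r → p + r ≤ q + r → p ≤ q
+-cancelʳ-≤ {p} {q} r p+r≤q+r =
  subst₂ _≤_ (cancel p) (cancel q) (ℚP.+-monoˡ-≤ (- r) p+r≤q+r)
  where
  cancel : ∀ s → s + r - r ≡ s
  cancel s = solve 2 (λ s r → s :+ r :- r := s) refl s r

*≤⇒≤*inv : ∀ {d p q} → d * inv d ≡ 1ℚ → 0ℚ ≤ inv d → d * p ≤ q → p ≤ q * inv d
*≤⇒≤*inv {d} {p} {q} d*d⁻¹≡1 0≤d⁻¹ d*p≤q = subst (_≤ q * inv d)
  (trans (solve 3 (λ d p i → d :* p :* i := p :* (d :* i)) refl d p (inv d))
         (trans (cong (p *_) d*d⁻¹≡1) (ℚP.*-identityʳ p)))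
  (*-monoʳ-≤-nonNeg (inv d) 0≤d⁻¹ d*p≤q)

*-pos : ∀ {p q} → 0ℚ < p → 0ℚ < q → 0ℚ < p * q
*-pos {p} {q} 0<p 0<q = ℚP.positive⁻¹ (p * q) {{ℚP.pos*pos⇒pos p {{positive 0<p}} q {{positive 0<q}}}}

^-nonNeg : ∀ {r} → 0ℚ ≤ r → ∀ k → 0ℚ ≤ r ^ k
^-nonNeg 0≤r zero    = 0≤1
^-nonNeg 0≤r (suc k) = *-nonNeg 0≤r (^-nonNeg 0≤r k)

ℕ→ℚ-^ : ∀ a k → ℕ→ℚ (a ℕ.^ k) ≡ ℕ→ℚ a ^ k
ℕ→ℚ-^ a zero    = refl
ℕ→ℚ-^ a (suc k) = trans (ℕ→ℚ-* a (a ℕ.^ k)) (cong (ℕ→ℚ a *_) (ℕ→ℚ-^ a k))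

^-≤-1 : ∀ {q} → 0ℚ ≤ q → q ≤ 1ℚ → ∀ k → q ^ k ≤ 1ℚ
^-≤-1 0≤q q≤1 zero    = ℚP.≤-refl
^-≤-1 {q} 0≤q q≤1 (suc k) = ℚP.≤-trans (*-monoˡ-≤-nonNeg q 0≤q (^-≤-1 0≤q q≤1 k))
                                          (subst (_≤ 1ℚ) (sym (ℚP.*-identityʳ q)) q≤1)

^-suc-≤ : ∀ {q} → 0ℚ ≤ q → q ≤ 1ℚ → ∀ k → q ^ suc k ≤ q
^-suc-≤ {q} 0≤q q≤1 k = subst (q * q ^ k ≤_) (ℚP.*-identityʳ q) (*-monoˡ-≤-nonNeg q 0≤q (^-≤-1 0≤q q≤1 k))

N*a^ℓ≤ℓ*a : ∀ {N ℓ a} → 0ℚ ≤ a → N ℕ.≤ 2 ℕ.^ ℓ → 2 ℕ.≤ ℓ → ℕ→ℚ ℓ * a ≤ 1ℚ → ℕ→ℚ N * a ^ ℓ ≤ ℕ→ℚ ℓ * a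
N*a^ℓ≤ℓ*a {N} {ℓ@(suc ℓ′)} {a} 0≤a N≤2^ℓ 2≤ℓ ℓa≤1 = begin
  ℕ→ℚ N * a ^ ℓ               ≤⟨ *-monoʳ-≤-nonNeg (a ^ ℓ) (^-nonNeg 0≤a ℓ) (ℕ→ℚ-mono-≤ N≤2^ℓ) ⟩
  ℕ→ℚ (2 ℕ.^ ℓ) * a ^ ℓ        ≡⟨ cong (_* a ^ ℓ) (ℕ→ℚ-^ 2 ℓ) ⟩
  ℕ→ℚ 2 ^ ℓ * a ^ ℓ            ≡⟨ ^-distrib-* (ℕ→ℚ 2) a ℓ ⟨
  (ℕ→ℚ 2 * a) ^ ℓ              ≤⟨ ^-suc-≤ (*-nonNeg (ℕ→ℚ-nonNeg 2) 0≤a) (ℚP.≤-trans 2a≤ℓa ℓa≤1) ℓ′ ⟩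
  ℕ→ℚ 2 * a                    ≤⟨ 2a≤ℓa ⟩
  ℕ→ℚ ℓ * a                    ∎
  where
  open ℚP.≤-Reasoning
  2a≤ℓa : ℕ→ℚ 2 * a ≤ ℕ→ℚ ℓ * a
  2a≤ℓa = *-monoʳ-≤-nonNeg a 0≤a (ℕ→ℚ-mono-≤ 2≤ℓ)

÷₀-sandwich : ∀ {p x d lo hi} → 0ℚ ≤ d → p ≡ x * inv d → lo ≤ x → x ≤ hi → (lo ÷₀ d ≤ p) × (p ≤ hi ÷₀ d)
÷₀-sandwich {p} {x} {d} {lo} {hi} 0≤d refl lo≤x x≤hi =
  subst (_≤ p) (sym (÷₀≡*inv lo d)) (*-monoʳ-≤-nonNeg (inv d) (inv-nonNeg 0≤d) lo≤x) ,
  subst (p ≤_) (sym (÷₀≡*inv hi d)) (*-monoʳ-≤-nonNeg (inv d) (inv-nonNeg 0≤d) x≤hi)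

iverson : Bool → ℚ
iverson true  = 1ℚ
iverson false = 0ℚ

iverson-nonNeg : ∀ b → 0ℚ ≤ iverson b
iverson-nonNeg true  = 0≤1
iverson-nonNeg false = ℚP.≤-refl

iverson-≤1 : ∀ b → iverson b ≤ 1ℚ
iverson-≤1 true  = ℚP.≤-refl
iverson-≤1 false = 0≤1

if-then-0≡iverson* : ∀ b x → (if b then x else 0ℚ) ≡ iverson b * x
if-then-0≡iverson* true  x = sym (ℚP.*-identityˡ x)
if-then-0≡iverson* false x = sym (ℚP.*-zeroˡ x)

module _ {A : Set} (_≟_ : DecidableEquality A) where

  δ : A → A → ℚ
  δ x y = iverson (does (x ≟ y))

  δ-refl : ∀ x → δ x x ≡ 1ℚ
  δ-refl x with x ≟ x
  ... | yes _  = refl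
  ... | no x≢x = contradiction refl x≢x

  δ-≢ : ∀ {x y} → x ≢ y → δ x y ≡ 0ℚ
  δ-≢ {x} {y} x≢y with x ≟ y
  ... | yes x≡y = contradiction x≡y x≢y
  ... | no _    = refl

  δ-sym : ∀ x y → δ x y ≡ δ y x
  δ-sym x y with x ≟ y
  ... | yes refl = sym (δ-refl x)
  ... | no x≢y   = sym (δ-≢ (x≢y ∘ sym))

  δ-nonNeg : ∀ x y → 0ℚ ≤ δ x y
  δ-nonNeg x y = iverson-nonNeg (does (x ≟ y))

δ-injective : ∀ {A B : Set} (_≟ᴬ_ : DecidableEquality A) (_≟ᴮ_ : DecidableEquality B) {f : A → B} →
  (∀ {x y} → f x ≡ f y → x ≡ y) → ∀ x y → δ _≟ᴮ_ (f x) (f y) ≡ δ _≟ᴬ_ x y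
δ-injective _≟ᴬ_ _≟ᴮ_ f-inj x y with x ≟ᴬ y
... | yes refl = δ-refl _≟ᴮ_ _
... | no x≢y   = δ-≢ _≟ᴮ_ (λ fx≡fy → x≢y (f-inj fx≡fy))

δF : ∀ {n} → Fin n → Fin n → ℚ
δF = δ FinP._≟_

module _ {n : ℕ} where

  δjust : Fin n → Maybe (Fin n) → ℚ
  δjust v o = δ (MaybeP.≡-dec FinP._≟_) o (just v)

  δjust-just : ∀ v u → δjust v (just u) ≡ δF u v
  δjust-just v u = δ-injective FinP._≟_ (MaybeP.≡-dec FinP._≟_) {f = just} (λ { refl → refl }) u v

  δjust-nothing : ∀ v → δjust v nothing ≡ 0ℚ
  δjust-nothing v = δ-≢ (MaybeP.≡-dec FinP._≟_) {nothing} {just v} (λ ())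

sum-mono-≤ : ∀ {n} {f g : Fin n → ℚ} → (∀ i → f i ≤ g i) → sum f ≤ sum g
sum-mono-≤ {zero}  _   = ℚP.≤-refl
sum-mono-≤ {suc n} f≤g = ℚP.+-mono-≤ (f≤g zero) (sum-mono-≤ (λ i → f≤g (suc i)))

sum-nonNeg : ∀ {n} {f : Fin n → ℚ} → (∀ i → 0ℚ ≤ f i) → 0ℚ ≤ sum f
sum-nonNeg {n} {f} 0≤f = subst (_≤ sum f) (sum-replicate-zero n) (sum-mono-≤ 0≤f)

term-≤-sum : ∀ {n} {f : Fin n → ℚ} → (∀ i → 0ℚ ≤ f i) → ∀ i → f i ≤ sum f
term-≤-sum {suc n} {f} 0≤f zero    = p≤p+q (sum-nonNeg (λ i → 0≤f (suc i)))
term-≤-sum {suc n} {f} 0≤f (suc i) = ℚP.≤-trans (term-≤-sum (λ i → 0≤f (suc i)) i) (p≤q+p (0≤f zero))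

sum-const : ∀ n c → ∑[ i < n ] c ≡ ℕ→ℚ n * c
sum-const zero    c = sym (ℚP.*-zeroˡ c)
sum-const (suc n) c = begin
  c + ∑[ i < n ] c       ≡⟨ cong (c +_) (sum-const n c) ⟩
  c + ℕ→ℚ n * c          ≡⟨ solve 2 (λ c k → c :+ k :* c := (con 1ℚ :+ k) :* c) refl c (ℕ→ℚ n) ⟩
  (1ℚ + ℕ→ℚ n) * c       ≡⟨ cong (_* c) (sym (ℕ→ℚ-suc n)) ⟩
  ℕ→ℚ (suc n) * c        ∎
  where open ≡-Reasoning

sum-*δ : ∀ {n} (g : Fin n → ℚ) v → ∑[ w < n ] (g w * δF w v) ≡ g v
sum-*δ {suc n} g zero = begin
  g zero * δF {suc n} zero zero + ∑[ w < n ] (g (suc w) * δF (suc w) zero)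
    ≡⟨ cong₂ _+_ (cong (g zero *_) (δ-refl (FinP._≟_ {suc n}) zero))
                 (sum-cong-≗ (λ w → cong (g (suc w) *_) (δ-≢ (FinP._≟_ {suc n}) {suc w} {zero} (λ ())))) ⟩
  g zero * 1ℚ + ∑[ w < n ] (g (suc w) * 0ℚ)
    ≡⟨ cong₂ _+_ (ℚP.*-identityʳ (g zero)) (trans (sum-cong-≗ (λ w → ℚP.*-zeroʳ (g (suc w)))) (sum-replicate-zero n)) ⟩
  g zero + 0ℚ
    ≡⟨ ℚP.+-identityʳ (g zero) ⟩
  g zero ∎
  where open ≡-Reasoning
sum-*δ {suc n} g (suc v) = begin
  g zero * δF zero (suc v) + ∑[ w < n ] (g (suc w) * δF (suc w) (suc v))
    ≡⟨ cong₂ _+_ (cong (g zero *_) (δ-≢ (FinP._≟_ {suc n}) {zero} {suc v} (λ ())))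
                 (sum-cong-≗ (λ w → cong (g (suc w) *_) (δ-injective FinP._≟_ FinP._≟_ FinP.suc-injective w v))) ⟩
  g zero * 0ℚ + ∑[ w < n ] (g (suc w) * δF w v)
    ≡⟨ cong₂ _+_ (ℚP.*-zeroʳ (g zero)) (sum-*δ (g ∘ suc) v) ⟩
  0ℚ + g (suc v)
    ≡⟨ ℚP.+-identityˡ (g (suc v)) ⟩
  g (suc v) ∎
  where open ≡-Reasoning

sum-δ* : ∀ {n} (g : Fin n → ℚ) v → ∑[ w < n ] (δF v w * g w) ≡ g v
sum-δ* g v = trans (sum-cong-≗ (λ w → trans (ℚP.*-comm (δF v w) (g w)) (cong (g w *_) (δ-sym FinP._≟_ v w)))) (sum-*δ g v)

∑δjust≤1 : ∀ {n} (o : Maybe (Fin n)) → ∑[ v < n ] δjust v o ≤ 1ℚ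
∑δjust≤1 {n} nothing  = subst (_≤ 1ℚ) (sym (trans (sum-cong-≗ {n} δjust-nothing) (sum-replicate-zero n))) 0≤1
∑δjust≤1 {n} (just u) = ℚP.≤-reflexive (trans (sum-cong-≗ (λ v → trans (δjust-just v u) (sym (ℚP.*-identityʳ (δF u v)))))
                                              (sum-δ* (λ _ → 1ℚ) u))

sumList : ∀ {A : Set} → List A → (A → ℚ) → ℚ
sumList []       g = 0ℚ
sumList (x ∷ xs) g = g x + sumList xs g

sumList-cong : ∀ {A : Set} (xs : List A) {g h : A → ℚ} → (∀ x → g x ≡ h x) → sumList xs g ≡ sumList xs h
sumList-cong []       _   = refl
sumList-cong (x ∷ xs) g≗h = cong₂ _+_ (g≗h x) (sumList-cong xs g≗h)

sumList-*ˡ : ∀ {A : Set} c (xs : List A) g → sumList xs (λ x → c * g x) ≡ c * sumList xs g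
sumList-*ˡ c []       g = sym (ℚP.*-zeroʳ c)
sumList-*ˡ c (x ∷ xs) g = trans (cong (c * g x +_) (sumList-*ˡ c xs g)) (sym (ℚP.*-distribˡ-+ c (g x) _))

sumList-filter : ∀ {A : Set} {P : A → Set} (P? : Decidable P) xs g →
  sumList (filter P? xs) g ≡ sumList xs (λ x → iverson (does (P? x)) * g x)
sumList-filter P? []       g = refl
sumList-filter P? (x ∷ xs) g with does (P? x)
... | true  = cong₂ _+_ (sym (ℚP.*-identityˡ (g x))) (sumList-filter P? xs g)
... | false = trans (sumList-filter P? xs g) (sym (trans (cong (_+ _) (ℚP.*-zeroˡ (g x))) (ℚP.+-identityˡ _)))

sumList-tabulate : ∀ {A : Set} n (f : Fin n → A) g → sumList (tabulate f) g ≡ ∑[ i < n ] g (f i)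
sumList-tabulate zero    f g = refl
sumList-tabulate (suc n) f g = cong (g (f zero) +_) (sumList-tabulate n (f ∘ suc) g)

sumList-applyUpTo : ∀ {A : Set} n (f : ℕ → A) g → sumList (applyUpTo f n) g ≡ ∑[ i < n ] g (f (toℕ i))
sumList-applyUpTo zero    f g = refl
sumList-applyUpTo (suc n) f g = cong (g (f 0) +_) (sumList-applyUpTo n (f ∘ suc) g)

length≡sumList-1 : ∀ {A : Set} (xs : List A) → ℕ→ℚ (length xs) ≡ sumList xs (λ _ → 1ℚ)
length≡sumList-1 []       = refl
length≡sumList-1 (x ∷ xs) = trans (ℕ→ℚ-suc (length xs)) (cong (1ℚ +_) (length≡sumList-1 xs))

𝔼 : ∀ {A : Set} → Dist A → (A → ℚ) → ℚ
𝔼 []             h = 0ℚ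
𝔼 ((a , p) ∷ d) h = p * h a + 𝔼 d h

Pr≡𝔼δ : ∀ {A : Set} (_≟_ : DecidableEquality A) d a → Pr _≟_ d a ≡ 𝔼 d (λ x → δ _≟_ x a)
Pr≡𝔼δ _≟_ []             a = refl
Pr≡𝔼δ _≟_ ((x , p) ∷ d) a =
  cong₂ _+_ (trans (if-then-0≡iverson* (does (x ≟ a)) p) (ℚP.*-comm _ p)) (Pr≡𝔼δ _≟_ d a)

𝔼-cong : ∀ {A : Set} (d : Dist A) {g h : A → ℚ} → (∀ a → g a ≡ h a) → 𝔼 d g ≡ 𝔼 d h
𝔼-cong []             _   = refl
𝔼-cong ((a , p) ∷ d) g≗h = cong₂ _+_ (cong (p *_) (g≗h a)) (𝔼-cong d g≗h)

𝔼-*ʳ : ∀ {A : Set} (d : Dist A) h c → 𝔼 d (λ a → h a * c) ≡ 𝔼 d h * c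
𝔼-*ʳ []             h c = sym (ℚP.*-zeroˡ c)
𝔼-*ʳ ((a , p) ∷ d) h c =
  trans (cong₂ _+_ (sym (ℚP.*-assoc p (h a) c)) (𝔼-*ʳ d h c)) (sym (ℚP.*-distribʳ-+ c (p * h a) _))

𝔼-++ : ∀ {A : Set} (d₁ d₂ : Dist A) h → 𝔼 (d₁ ++ d₂) h ≡ 𝔼 d₁ h + 𝔼 d₂ h
𝔼-++ []              d₂ h = sym (ℚP.+-identityˡ _)
𝔼-++ ((a , p) ∷ d₁) d₂ h = trans (cong (p * h a +_) (𝔼-++ d₁ d₂ h)) (sym (ℚP.+-assoc (p * h a) _ _))

𝔼-scale : ∀ {A : Set} c (d : Dist A) h → 𝔼 (map (λ aq → (proj₁ aq , c * proj₂ aq)) d) h ≡ c * 𝔼 d h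
𝔼-scale c []             h = sym (ℚP.*-zeroʳ c)
𝔼-scale c ((a , p) ∷ d) h =
  trans (cong₂ _+_ (ℚP.*-assoc c p (h a)) (𝔼-scale c d h)) (sym (ℚP.*-distribˡ-+ c (p * h a) _))

𝔼->>= : ∀ {A B : Set} (d : Dist A) (f : A → Dist B) h → 𝔼 (d >>= f) h ≡ 𝔼 d (λ a → 𝔼 (f a) h)
𝔼->>= []             f h = refl
𝔼->>= ((a , p) ∷ d) f h =
  trans (𝔼-++ (map (λ bq → (proj₁ bq , p * proj₂ bq)) (f a)) (d >>= f) h)
        (cong₂ _+_ (𝔼-scale p (f a) h) (𝔼->>= d f h))

𝔼-ret : ∀ {A : Set} (a : A) h → 𝔼 (ret a) h ≡ h a
𝔼-ret a h = trans (ℚP.+-identityʳ (1ℚ * h a)) (ℚP.*-identityˡ (h a))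

𝔼-coin : ∀ p h → 𝔼 (coin p) h ≡ p * h true + (1ℚ - p) * h false
𝔼-coin p h = cong (p * h true +_) (ℚP.+-identityʳ _)

1/suc≡inv : ∀ k → (ℤ.+ 1) / suc k ≡ inv (ℕ→ℚ (suc k))
1/suc≡inv k with ℕ→ℚ (suc k) ℚP.≟ 0ℚ
... | yes k+1≡0 = contradiction (sym k+1≡0) (ℚP.<⇒≢ (ℕ→ℚ-suc-pos k))
... | no k+1≢0 = trans (ℚP.↥p/↧p≡p (mkℚ (ℤ.+ 1) k (Coprime.1-coprimeTo (suc k))))
    (trans (1/mkℚ (ℕ→ℚ (suc k)) (ℕ→ℚ≡mkℚ (suc k)) {{≢-nonZero k+1≢0}})
           (sym (ℚP.*-identityˡ ((1/ ℕ→ℚ (suc k)) {{≢-nonZero k+1≢0}}))))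
  where
  1/mkℚ : ∀ q → q ≡ mkℚ (ℤ.+ suc k) 0 (Coprime.sym (Coprime.1-coprimeTo (suc k))) → .{{_ : NonZero q}} →
          mkℚ (ℤ.+ 1) k (Coprime.1-coprimeTo (suc k)) ≡ 1/ q
  1/mkℚ _ refl = refl

𝔼-uniform : ∀ {A : Set} (xs : List A) h → 𝔼 (uniform xs) h ≡ inv (ℕ→ℚ (length xs)) * sumList xs h
𝔼-uniform []       h = sym (ℚP.*-zeroʳ (inv 0ℚ))
𝔼-uniform (x ∷ xs) h =
  trans (go (x ∷ xs)) (trans (sumList-*ˡ c (x ∷ xs) h) (cong (_* sumList (x ∷ xs) h) (1/suc≡inv (length xs))))
  where
  c = (ℤ.+ 1) / length (x ∷ xs)
  go : ∀ ys → 𝔼 (map (λ y → (y , c)) ys) h ≡ sumList ys (λ y → c * h y)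
  go []       = refl
  go (y ∷ ys) = cong (c * h y +_) (go ys)

module _ {n : ℕ} where

  infixl 7 _⊙_ _⊗_

  _⊙_ : (Fin n → ℚ) → (Fin n → Fin n → ℚ) → Fin n → ℚ
  (x ⊙ A) z = ∑[ y < n ] (x y * A y z)

  _⊗_ : (Fin n → Fin n → ℚ) → (Fin n → Fin n → ℚ) → Fin n → Fin n → ℚ
  (A ⊗ B) x = A x ⊙ B

  power : (Fin n → Fin n → ℚ) → ℕ → Fin n → Fin n → ℚ
  power A zero    = δF
  power A (suc k) = A ⊗ power A k

  ⊙-congʳ : ∀ x {A B} → (∀ i j → A i j ≡ B i j) → ∀ z → (x ⊙ A) z ≡ (x ⊙ B) z
  ⊙-congʳ x A≗B z = sum-cong-≗ (λ i → cong (x i *_) (A≗B i z))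

  ⊙-⊗-assoc : ∀ x A B z → (x ⊙ A ⊙ B) z ≡ (x ⊙ (A ⊗ B)) z
  ⊙-⊗-assoc x A B z = begin
    ∑[ y < n ] (∑[ w < n ] (x w * A w y) * B y z)
      ≡⟨ sum-cong-≗ (λ y → *-distribʳ-sum (B y z) (λ w → x w * A w y)) ⟩
    ∑[ y < n ] ∑[ w < n ] (x w * A w y * B y z)
      ≡⟨ ∑-comm (λ y w → x w * A w y * B y z) ⟩
    ∑[ w < n ] ∑[ y < n ] (x w * A w y * B y z)
      ≡⟨ sum-cong-≗ (λ w → sum-cong-≗ (λ y → ℚP.*-assoc (x w) (A w y) (B y z))) ⟩
    ∑[ w < n ] ∑[ y < n ] (x w * (A w y * B y z))
      ≡⟨ sum-cong-≗ (λ w → sym (*-distribˡ-sum (x w) (λ y → A w y * B y z))) ⟩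
    ∑[ w < n ] (x w * ∑[ y < n ] (A w y * B y z)) ∎
    where open ≡-Reasoning

  ⊙-δF : ∀ x z → (x ⊙ δF) z ≡ x z
  ⊙-δF = sum-*δ

  δF-⊙ : ∀ A x z → (δF x ⊙ A) z ≡ A x z
  δF-⊙ A x z = sum-δ* (λ y → A y z) x

  power-sucʳ : ∀ A k x z → power A (suc k) x z ≡ (power A k ⊗ A) x z
  power-sucʳ A zero    x z = trans (⊙-δF (A x) z) (sym (δF-⊙ A x z))
  power-sucʳ A (suc k) x z = begin
    (A x ⊙ power A (suc k)) z   ≡⟨ ⊙-congʳ (A x) (power-sucʳ A k) z ⟩
    (A x ⊙ (power A k ⊗ A)) z   ≡⟨ ⊙-⊗-assoc (A x) (power A k) A z ⟨
    (A x ⊙ power A k ⊙ A) z     ∎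
    where open ≡-Reasoning

  ∑-⊙ : ∀ k (x : Fin k → Fin n → ℚ) A z → ((λ y → ∑[ i < k ] x i y) ⊙ A) z ≡ ∑[ i < k ] (x i ⊙ A) z
  ∑-⊙ k x A z = begin
    ∑[ y < n ] (∑[ i < k ] x i y * A y z)  ≡⟨ sum-cong-≗ (λ y → *-distribʳ-sum (A y z) (λ i → x i y)) ⟩
    ∑[ y < n ] ∑[ i < k ] (x i y * A y z)  ≡⟨ ∑-comm (λ y i → x i y * A y z) ⟩
    ∑[ i < k ] ∑[ y < n ] (x i y * A y z)  ∎
    where open ≡-Reasoning

  ⊙-nonNeg : ∀ {x A} → (∀ i → 0ℚ ≤ x i) → (∀ i j → 0ℚ ≤ A i j) → ∀ z → 0ℚ ≤ (x ⊙ A) z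
  ⊙-nonNeg 0≤x 0≤A z = sum-nonNeg (λ y → *-nonNeg (0≤x y) (0≤A y z))

  power-nonNeg : ∀ {A : Fin n → Fin n → ℚ} → (∀ x y → 0ℚ ≤ A x y) → ∀ k x z → 0ℚ ≤ power A k x z
  power-nonNeg 0≤A zero    x z = δ-nonNeg FinP._≟_ x z
  power-nonNeg 0≤A (suc k) x z = ⊙-nonNeg (0≤A x) (power-nonNeg 0≤A k) z

  power-≤-^ : ∀ {A : Fin n → Fin n → ℚ} {r} → (∀ x y → 0ℚ ≤ A x y) → 0ℚ ≤ r →
    (∀ z → ∑[ y < n ] A y z ≤ r) → ∀ k x z → power A k x z ≤ r ^ k
  power-≤-^ 0≤A 0≤r colSum≤r zero x z = iverson-≤1 (does (x FinP.≟ z))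
  power-≤-^ {A} {r} 0≤A 0≤r colSum≤r (suc k) x z = begin
    power A (suc k) x z                ≡⟨ power-sucʳ A k x z ⟩
    ∑[ y < n ] (power A k x y * A y z) ≤⟨ sum-mono-≤ (λ y → *-monoʳ-≤-nonNeg (A y z) (0≤A y z)
                                              (power-≤-^ 0≤A 0≤r colSum≤r k x y)) ⟩
    ∑[ y < n ] (r ^ k * A y z)         ≡⟨ *-distribˡ-sum (r ^ k) (λ y → A y z) ⟨
    r ^ k * ∑[ y < n ] A y z           ≤⟨ *-monoˡ-≤-nonNeg (r ^ k) (^-nonNeg 0≤r k) (colSum≤r z) ⟩
    r ^ k * r                          ≡⟨ ℚP.*-comm (r ^ k) r ⟩
    r ^ suc k                          ∎
    where open ℚP.≤-Reasoning

  rowSum-⊗ : ∀ A B x → ∑[ z < n ] (A ⊗ B) x z ≡ ∑[ y < n ] (A x y * ∑[ z < n ] B y z)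
  rowSum-⊗ A B x = begin
    ∑[ z < n ] ∑[ y < n ] (A x y * B y z) ≡⟨ ∑-comm (λ z y → A x y * B y z) ⟩
    ∑[ y < n ] ∑[ z < n ] (A x y * B y z) ≡⟨ sum-cong-≗ (λ y → *-distribˡ-sum (A x y) (B y)) ⟨
    ∑[ y < n ] (A x y * ∑[ z < n ] B y z) ∎
    where open ≡-Reasoning

module RandomWalk {n : ℕ} (G : Graph n) (θ : ℚ) where
  open Procedures G

  degℚ : Fin n → ℚ
  degℚ u = ℕ→ℚ (deg G u)

  adjℚ : Fin n → Fin n → ℚ
  adjℚ u w = iverson (adj G u w)

  heavyℚ : Fin n → ℚ
  heavyℚ u = iverson (heavy θ u)

  step : Fin n → Fin n → ℚ
  step u w = inv (degℚ u) * (adjℚ u w * heavyℚ w)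

  acceptance : Fin n → ℚ
  acceptance u = if heavy θ u then 0ℚ else degℚ u ÷₀ θ

  leaf : Fin n → ℚ
  leaf u = inv (ℕ→ℚ n) * acceptance u

  reach : ℕ → Fin n → ℚ
  reach j = leaf ⊙ power step j

  reachBefore : ℕ → Fin n → ℚ
  reachBefore k v = ∑[ j < k ] reach (toℕ j) v

  sumList-nbrs : ∀ u g → sumList (nbrs G u) g ≡ ∑[ w < n ] (adjℚ u w * g w)
  sumList-nbrs u g = begin
    sumList (nbrs G u) g
      ≡⟨ sumList-filter (λ w → adj G u w Bool.≟ true) (allFin n) g ⟩
    sumList (allFin n) (λ w → iverson (does (adj G u w Bool.≟ true)) * g w)
      ≡⟨ sumList-tabulate n (λ w → w) _ ⟩
    ∑[ w < n ] (iverson (does (adj G u w Bool.≟ true)) * g w)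
      ≡⟨ sum-cong-≗ (λ w → cong (λ b → iverson b * g w) (≟true (adj G u w))) ⟩
    ∑[ w < n ] (adjℚ u w * g w) ∎
    where
    open ≡-Reasoning
    ≟true : ∀ b → does (b Bool.≟ true) ≡ b
    ≟true true  = refl
    ≟true false = refl

  degℚ≡∑adjℚ : ∀ u → degℚ u ≡ ∑[ w < n ] adjℚ u w
  degℚ≡∑adjℚ u = trans (length≡sumList-1 (nbrs G u))
    (trans (sumList-nbrs u (λ _ → 1ℚ)) (sum-cong-≗ (λ w → ℚP.*-identityʳ (adjℚ u w))))

  𝔼-uniform-nbrs : ∀ u g → 𝔼 (uniform (nbrs G u)) g ≡ inv (degℚ u) * ∑[ w < n ] (adjℚ u w * g w)
  𝔼-uniform-nbrs u g = trans (𝔼-uniform (nbrs G u) g) (cong (inv (degℚ u) *_) (sumList-nbrs u g))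

  𝔼-fail : ∀ {A : Set} (h : Maybe A → ℚ) → 𝔼 fail h ≡ h nothing
  𝔼-fail = 𝔼-ret nothing

  𝔼-if-fail : ∀ {A : Set} b (d : Dist (Maybe A)) h → h nothing ≡ 0ℚ →
    𝔼 (if b then d else fail) h ≡ iverson b * 𝔼 d h
  𝔼-if-fail true  d h _      = sym (ℚP.*-identityˡ (𝔼 d h))
  𝔼-if-fail false d h h[⊥]≡0 = trans (𝔼-fail h) (trans h[⊥]≡0 (sym (ℚP.*-zeroˡ (𝔼 d h))))

  𝔼-walk : ∀ j u v → 𝔼 (walk θ j u) (δjust v) ≡ power step j u v
  𝔼-walk zero    u v = trans (𝔼-ret (just u) (δjust v)) (δjust-just v u)
  𝔼-walk (suc j) u v = begin
    𝔼 (uniform (nbrs G u) >>= next) (δjust v)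
      ≡⟨ 𝔼->>= (uniform (nbrs G u)) next (δjust v) ⟩
    𝔼 (uniform (nbrs G u)) (λ w → 𝔼 (next w) (δjust v))
      ≡⟨ 𝔼-uniform-nbrs u _ ⟩
    inv (degℚ u) * ∑[ w < n ] (adjℚ u w * 𝔼 (next w) (δjust v))
      ≡⟨ cong (inv (degℚ u) *_) (sum-cong-≗ λ w → cong (adjℚ u w *_) (trans
           (𝔼-if-fail (heavy θ w) (walk θ j w) (δjust v) (δjust-nothing v))
           (cong (heavyℚ w *_) (𝔼-walk j w v)))) ⟩
    inv (degℚ u) * ∑[ w < n ] (adjℚ u w * (heavyℚ w * power step j w v))
      ≡⟨ *-distribˡ-sum (inv (degℚ u)) (λ w → adjℚ u w * (heavyℚ w * power step j w v)) ⟩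
    ∑[ w < n ] (inv (degℚ u) * (adjℚ u w * (heavyℚ w * power step j w v)))
      ≡⟨ sum-cong-≗ (λ w → solve 4 (λ i a h p → i :* (a :* (h :* p)) := i :* (a :* h) :* p)
           refl (inv (degℚ u)) (adjℚ u w) (heavyℚ w) (power step j w v)) ⟩
    ∑[ w < n ] (step u w * power step j w v) ∎
    where
    open ≡-Reasoning
    next : Fin n → Dist (Maybe (Fin n))
    next w = if heavy θ w then walk θ j w else fail

  𝔼-sampleALeaf : ∀ (K : Maybe (Fin n) → ℚ) → K nothing ≡ 0ℚ →
    𝔼 (sampleALeaf θ) K ≡ ∑[ u < n ] (leaf u * K (just u))
  𝔼-sampleALeaf K K[⊥]≡0 = begin
    𝔼 (uniform (allFin n) >>= try) K
      ≡⟨ 𝔼->>= (uniform (allFin n)) try K ⟩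
    𝔼 (uniform (allFin n)) (λ u → 𝔼 (try u) K)
      ≡⟨ 𝔼-uniform (allFin n) _ ⟩
    inv (ℕ→ℚ (length (allFin n))) * sumList (allFin n) (λ u → 𝔼 (try u) K)
      ≡⟨ cong₂ _*_ (cong (inv ∘ ℕ→ℚ) (ListP.length-tabulate {n = n} (λ u → u)))
                   (trans (sumList-tabulate n (λ u → u) _) (sum-cong-≗ 𝔼-try)) ⟩
    inv (ℕ→ℚ n) * ∑[ u < n ] (acceptance u * K (just u))
      ≡⟨ *-distribˡ-sum (inv (ℕ→ℚ n)) (λ u → acceptance u * K (just u)) ⟩
    ∑[ u < n ] (inv (ℕ→ℚ n) * (acceptance u * K (just u)))
      ≡⟨ sum-cong-≗ (λ u → sym (ℚP.*-assoc (inv (ℕ→ℚ n)) (acceptance u) (K (just u)))) ⟩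
    ∑[ u < n ] (leaf u * K (just u)) ∎
    where
    open ≡-Reasoning
    accept : Fin n → Bool → Dist (Maybe (Fin n))
    accept u b = if b then ret (just u) else fail
    try : Fin n → Dist (Maybe (Fin n))
    try u = if heavy θ u then fail else (coin (degℚ u ÷₀ θ) >>= accept u)
    𝔼-try : ∀ u → 𝔼 (try u) K ≡ acceptance u * K (just u)
    𝔼-try u with heavy θ u
    ... | true  = trans (𝔼-fail K) (trans K[⊥]≡0 (sym (ℚP.*-zeroˡ (K (just u)))))
    ... | false = begin
      𝔼 (coin p >>= accept u) K
        ≡⟨ 𝔼->>= (coin p) (accept u) K ⟩
      𝔼 (coin p) (λ b → 𝔼 (accept u b) K)
        ≡⟨ 𝔼-coin p (λ b → 𝔼 (accept u b) K) ⟩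
      p * 𝔼 (ret (just u)) K + (1ℚ - p) * 𝔼 fail K
        ≡⟨ cong₂ (λ a b → p * a + (1ℚ - p) * b) (𝔼-ret (just u) K) (trans (𝔼-fail K) K[⊥]≡0) ⟩
      p * K (just u) + (1ℚ - p) * 0ℚ
        ≡⟨ solve 2 (λ p k → p :* k :+ (con 1ℚ :- p) :* con 0ℚ := p :* k) refl p (K (just u)) ⟩
      p * K (just u) ∎
      where p = degℚ u ÷₀ θ

  𝔼-randomWalk : ∀ j v → 𝔼 (randomWalk θ j) (δjust v) ≡ reach j v
  𝔼-randomWalk j v = trans (𝔼->>= (sampleALeaf θ) _ (δjust v))
    (trans (𝔼-sampleALeaf _ (trans (𝔼-fail (δjust v)) (δjust-nothing v)))
           (sum-cong-≗ (λ u → cong (leaf u *_) (𝔼-walk j u v))))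

  reach-zero : ∀ v → reach 0 v ≡ leaf v
  reach-zero = ⊙-δF leaf

  reach-suc : ∀ j v → reach (suc j) v ≡ (reach j ⊙ step) v
  reach-suc j v = trans (⊙-congʳ leaf (power-sucʳ step j) v) (sym (⊙-⊗-assoc leaf (power step j) step v))

  reachBefore-suc : ∀ k v → reachBefore (suc k) v ≡ leaf v + (reachBefore k ⊙ step) v
  reachBefore-suc k v = cong₂ _+_ (reach-zero v)
    (trans (sum-cong-≗ {k} (λ j → reach-suc (toℕ j) v))
           (sym (∑-⊙ k (λ j → reach (toℕ j)) step v)))

  ⊙-step : ∀ x v → (x ⊙ step) v ≡ heavyℚ v * ∑[ y < n ] (adjℚ v y * (x y * inv (degℚ y)))
  ⊙-step x v = begin
    ∑[ y < n ] (x y * (inv (degℚ y) * (adjℚ y v * heavyℚ v)))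
      ≡⟨ sum-cong-≗ (λ y → trans (cong (λ b → x y * (inv (degℚ y) * (iverson b * heavyℚ v))) (symm G y v))
           (solve 4 (λ x i a h → x :* (i :* (a :* h)) := h :* (a :* (x :* i))) refl (x y) (inv (degℚ y)) (adjℚ v y) (heavyℚ v))) ⟩
    ∑[ y < n ] (heavyℚ v * (adjℚ v y * (x y * inv (degℚ y))))
      ≡⟨ *-distribˡ-sum (heavyℚ v) (λ y → adjℚ v y * (x y * inv (degℚ y))) ⟨
    heavyℚ v * ∑[ y < n ] (adjℚ v y * (x y * inv (degℚ y))) ∎
    where open ≡-Reasoning

  -- The continuation P is a parameter so that it unifies with the anonymous pattern-matching
  -- lambda in the definition of sampleEdge, which cannot be named.
  𝔼-averageOfWalks : ∀ {B : Set} m (P : ℕ → Maybe (Fin n) → Dist B) h K → (∀ j o → 𝔼 (P j o) h ≡ K o) →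
    𝔼 (uniform (upTo (suc m)) >>= λ j → randomWalk θ j >>= P j) h ≡
    inv (ℕ→ℚ (suc m)) * ∑[ j < suc m ] 𝔼 (randomWalk θ (toℕ j)) K
  𝔼-averageOfWalks m P h K 𝔼P≡K = begin
    𝔼 (uniform (upTo (suc m)) >>= λ j → randomWalk θ j >>= P j) h
      ≡⟨ 𝔼->>= (uniform (upTo (suc m))) (λ j → randomWalk θ j >>= P j) h ⟩
    𝔼 (uniform (upTo (suc m))) (λ j → 𝔼 (randomWalk θ j >>= P j) h)
      ≡⟨ 𝔼-uniform (upTo (suc m)) _ ⟩
    inv (ℕ→ℚ (length (upTo (suc m)))) * sumList (upTo (suc m)) (λ j → 𝔼 (randomWalk θ j >>= P j) h)
      ≡⟨ cong₂ _*_ (cong (inv ∘ ℕ→ℚ) (ListP.length-upTo (suc m))) (sumList-cong (upTo (suc m)) 𝔼-walk-then-P) ⟩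
    inv (ℕ→ℚ (suc m)) * sumList (upTo (suc m)) (λ j → 𝔼 (randomWalk θ j) K)
      ≡⟨ cong (inv (ℕ→ℚ (suc m)) *_) (sumList-applyUpTo (suc m) (λ j → j) (λ j → 𝔼 (randomWalk θ j) K)) ⟩
    inv (ℕ→ℚ (suc m)) * ∑[ j < suc m ] 𝔼 (randomWalk θ (toℕ j)) K ∎
    where
    open ≡-Reasoning
    𝔼-walk-then-P : ∀ j → 𝔼 (randomWalk θ j >>= P j) h ≡ 𝔼 (randomWalk θ j) K
    𝔼-walk-then-P j = trans (𝔼->>= (randomWalk θ j) (P j) h) (𝔼-cong (randomWalk θ j) (𝔼P≡K j))

δ-outcome : ∀ {n} (a b c d : Fin n) → δ outcome-≟ (just (a , b)) (just (c , d)) ≡ δF a c * δF b d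
δ-outcome a b c d = by-cases (a FinP.≟ c) (b FinP.≟ d)
  where
  by-cases : Dec (a ≡ c) → Dec (b ≡ d) → δ outcome-≟ (just (a , b)) (just (c , d)) ≡ δF a c * δF b d
  by-cases (yes refl) (yes refl) = trans (δ-refl outcome-≟ (just (a , b)))
    (sym (trans (cong₂ _*_ (δ-refl FinP._≟_ a) (δ-refl FinP._≟_ b)) (ℚP.*-identityˡ 1ℚ)))
  by-cases (no a≢c) _ = trans (δ-≢ outcome-≟ {just (a , b)} {just (c , d)} (λ { refl → a≢c refl }))
    (sym (trans (cong (_* δF b d) (δ-≢ FinP._≟_ a≢c)) (ℚP.*-zeroˡ (δF b d))))
  by-cases (yes _) (no b≢d) = trans (δ-≢ outcome-≟ {just (a , b)} {just (c , d)} (λ { refl → b≢d refl }))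
    (sym (trans (cong (δF a c *_) (δ-≢ FinP._≟_ b≢d)) (ℚP.*-zeroʳ (δF a c))))

module SampleEdge {n : ℕ} (G : Graph n) (α : ℕ) (ε : ℚ) where
  open Procedures G
  open RandomWalk G (θ-of α ε) public

  returns : Fin n → Fin n → Maybe (Fin n × Fin n) → ℚ
  returns v w o = δ outcome-≟ o (just (v , w))

  𝔼-edgeFrom : ∀ {v w} → IsEdge G v w → ∀ u →
    𝔼 (uniform (nbrs G u) >>= λ w′ → ret (just (u , w′))) (returns v w) ≡ δjust v (just u) * inv (degℚ v)
  𝔼-edgeFrom {v} {w} vw u = begin
    𝔼 (uniform (nbrs G u) >>= λ w′ → ret (just (u , w′))) (returns v w)
      ≡⟨ 𝔼->>= (uniform (nbrs G u)) (λ w′ → ret (just (u , w′))) (returns v w) ⟩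
    𝔼 (uniform (nbrs G u)) (λ w′ → 𝔼 (ret (just (u , w′))) (returns v w))
      ≡⟨ 𝔼-uniform-nbrs u _ ⟩
    inv (degℚ u) * ∑[ w′ < n ] (adjℚ u w′ * 𝔼 (ret (just (u , w′))) (returns v w))
      ≡⟨ cong (inv (degℚ u) *_) (sum-cong-≗ (λ w′ → cong (adjℚ u w′ *_)
           (trans (𝔼-ret (just (u , w′)) (returns v w)) (δ-outcome u w′ v w)))) ⟩
    inv (degℚ u) * ∑[ w′ < n ] (adjℚ u w′ * (δF u v * δF w′ w))
      ≡⟨ cong (inv (degℚ u) *_) (trans
           (sum-cong-≗ (λ w′ → sym (ℚP.*-assoc (adjℚ u w′) (δF u v) (δF w′ w))))
           (sum-*δ (λ w′ → adjℚ u w′ * δF u v) w)) ⟩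
    inv (degℚ u) * (adjℚ u w * δF u v)
      ≡⟨ at-v (u FinP.≟ v) ⟩
    δF u v * inv (degℚ v)
      ≡⟨ cong (_* inv (degℚ v)) (δjust-just v u) ⟨
    δjust v (just u) * inv (degℚ v) ∎
    where
    open ≡-Reasoning
    at-v : Dec (u ≡ v) → inv (degℚ u) * (adjℚ u w * δF u v) ≡ δF u v * inv (degℚ v)
    at-v (yes refl) = begin
      inv (degℚ u) * (adjℚ u w * δF u u) ≡⟨ cong₂ (λ a b → inv (degℚ u) * (iverson a * b)) vw (δ-refl FinP._≟_ u) ⟩
      inv (degℚ u) * (1ℚ * 1ℚ)           ≡⟨ solve 1 (λ i → i :* (con 1ℚ :* con 1ℚ) := con 1ℚ :* i) refl (inv (degℚ u)) ⟩
      1ℚ * inv (degℚ u)                  ≡⟨ cong (_* inv (degℚ u)) (δ-refl FinP._≟_ u) ⟨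
      δF u u * inv (degℚ u)              ∎
    at-v (no u≢v) = begin
      inv (degℚ u) * (adjℚ u w * δF u v) ≡⟨ cong (λ a → inv (degℚ u) * (adjℚ u w * a)) (δ-≢ FinP._≟_ u≢v) ⟩
      inv (degℚ u) * (adjℚ u w * 0ℚ)     ≡⟨ solve 3 (λ i a j → i :* (a :* con 0ℚ) := con 0ℚ :* j) refl (inv (degℚ u)) (adjℚ u w) (inv (degℚ v)) ⟩
      0ℚ * inv (degℚ v)                  ≡⟨ cong (_* inv (degℚ v)) (δ-≢ FinP._≟_ u≢v) ⟨
      δF u v * inv (degℚ v)              ∎

  PrSampleEdge≡ : ∀ {v w} → IsEdge G v w →
    PrSampleEdge G α ε v w ≡ inv (ℕ→ℚ (suc ℓ-of)) * (reachBefore (suc ℓ-of) v * inv (degℚ v))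
  PrSampleEdge≡ {v} {w} vw = begin
    PrSampleEdge G α ε v w
      ≡⟨ Pr≡𝔼δ outcome-≟ (sampleEdge α ε) (just (v , w)) ⟩
    𝔼 (sampleEdge α ε) (returns v w)
      ≡⟨ 𝔼-averageOfWalks ℓ-of _ (returns v w) (λ o → δjust v o * inv (degℚ v))
           (λ { _ nothing → 𝔼-fail-returns ; _ (just u) → 𝔼-edgeFrom vw u }) ⟩
    inv (ℕ→ℚ (suc ℓ-of)) * ∑[ j < suc ℓ-of ] 𝔼 (randomWalk (θ-of α ε) (toℕ j)) (λ o → δjust v o * inv (degℚ v))
      ≡⟨ cong (inv (ℕ→ℚ (suc ℓ-of)) *_) (trans
           (sum-cong-≗ {suc ℓ-of} (λ j → trans (𝔼-*ʳ (randomWalk (θ-of α ε) (toℕ j)) (δjust v) (inv (degℚ v)))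
                                    (cong (_* inv (degℚ v)) (𝔼-randomWalk (toℕ j) v))))
           (sym (*-distribʳ-sum {suc ℓ-of} (inv (degℚ v)) (λ j → reach (toℕ j) v)))) ⟩
    inv (ℕ→ℚ (suc ℓ-of)) * (reachBefore (suc ℓ-of) v * inv (degℚ v)) ∎
    where
    open ≡-Reasoning
    𝔼-fail-returns : 𝔼 fail (returns v w) ≡ δjust v nothing * inv (degℚ v)
    𝔼-fail-returns = begin
      𝔼 fail (returns v w)              ≡⟨ 𝔼-fail (returns v w) ⟩
      returns v w nothing               ≡⟨ δ-≢ outcome-≟ {nothing} {just (v , w)} (λ ()) ⟩
      0ℚ                                ≡⟨ ℚP.*-zeroˡ (inv (degℚ v)) ⟨
      0ℚ * inv (degℚ v)                 ≡⟨ cong (_* inv (degℚ v)) (δjust-nothing v) ⟨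
      δjust v nothing * inv (degℚ v)   ∎

module Bounds {n : ℕ} (G : Graph n) (θ : ℚ) (θ>0 : 0ℚ < θ) (n≢0 : ℕ→ℚ n ≢ 0ℚ) where
  open Procedures G
  open RandomWalk G θ

  nθ : ℚ
  nθ = ℕ→ℚ n * θ

  mass : ℕ → Fin n → ℚ
  mass k x = reachBefore k x * nθ

  relativeMass : ℕ → Fin n → ℚ
  relativeMass k x = mass k x * inv (degℚ x)

  θ≢0 : θ ≢ 0ℚ
  θ≢0 θ≡0 = ℚP.<-irrefl (sym θ≡0) θ>0

  0≤θ : 0ℚ ≤ θ
  0≤θ = ℚP.<⇒≤ θ>0

  heavy⇒θ<degℚ : ∀ {x} → heavy θ x ≡ true → θ < degℚ x
  heavy⇒θ<degℚ {x} heavy-x = Dec.toWitness {a? = θ ℚP.<? degℚ x} (subst T (sym heavy-x) tt)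

  degℚ-nonNeg : ∀ x → 0ℚ ≤ degℚ x
  degℚ-nonNeg x = ℕ→ℚ-nonNeg (deg G x)

  adjacent⇒degℚ*inv≡1 : ∀ {x y} → adj G x y ≡ true → degℚ y * inv (degℚ y) ≡ 1ℚ
  adjacent⇒degℚ*inv≡1 {x} {y} xy = inv-inverseʳ (λ dy≡0 → ℚP.<-irrefl refl (ℚP.<-≤-trans (ℚP.positive⁻¹ 1ℚ)
    (subst (1ℚ ≤_) dy≡0 (subst (_≤ degℚ y) (cong iverson (trans (symm G y x) xy))
      (subst (adjℚ y x ≤_) (sym (degℚ≡∑adjℚ y)) (term-≤-sum (λ z → iverson-nonNeg (adj G y z)) x))))))

  leaf-nonNeg : ∀ x → 0ℚ ≤ leaf x
  leaf-nonNeg x = *-nonNeg (inv-nonNeg (ℕ→ℚ-nonNeg n)) (acceptance-nonNeg (heavy θ x))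
    where
    acceptance-nonNeg : ∀ b → 0ℚ ≤ (if b then 0ℚ else degℚ x ÷₀ θ)
    acceptance-nonNeg true  = ℚP.≤-refl
    acceptance-nonNeg false = subst (0ℚ ≤_) (sym (÷₀≡*inv (degℚ x) θ)) (*-nonNeg (degℚ-nonNeg x) (inv-nonNeg 0≤θ))

  leaf-heavy : ∀ {x} → heavy θ x ≡ true → leaf x ≡ 0ℚ
  leaf-heavy {x} heavy-x =
    trans (cong (λ b → inv (ℕ→ℚ n) * (if b then 0ℚ else degℚ x ÷₀ θ)) heavy-x) (ℚP.*-zeroʳ (inv (ℕ→ℚ n)))

  leaf-light : ∀ {x} → heavy θ x ≡ false → leaf x * nθ ≡ degℚ x
  leaf-light {x} light-x = begin
    leaf x * nθ
      ≡⟨ cong (λ b → inv (ℕ→ℚ n) * (if b then 0ℚ else degℚ x ÷₀ θ) * nθ) light-x ⟩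
    inv (ℕ→ℚ n) * (degℚ x ÷₀ θ) * (ℕ→ℚ n * θ)
      ≡⟨ cong (λ p → inv (ℕ→ℚ n) * p * (ℕ→ℚ n * θ)) (÷₀≡*inv (degℚ x) θ) ⟩
    inv (ℕ→ℚ n) * (degℚ x * inv θ) * (ℕ→ℚ n * θ)
      ≡⟨ solve 5 (λ i d j k t → i :* (d :* j) :* (k :* t) := (k :* i) :* (d :* (t :* j)))
           refl (inv (ℕ→ℚ n)) (degℚ x) (inv θ) (ℕ→ℚ n) θ ⟩
    (ℕ→ℚ n * inv (ℕ→ℚ n)) * (degℚ x * (θ * inv θ))
      ≡⟨ cong₂ (λ p q → p * (degℚ x * q)) (inv-inverseʳ n≢0) (inv-inverseʳ θ≢0) ⟩
    1ℚ * (degℚ x * 1ℚ)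
      ≡⟨ solve 1 (λ d → con 1ℚ :* (d :* con 1ℚ) := d) refl (degℚ x) ⟩
    degℚ x ∎
    where open ≡-Reasoning

  step-nonNeg : ∀ x y → 0ℚ ≤ step x y
  step-nonNeg x y = *-nonNeg (inv-nonNeg (degℚ-nonNeg x)) (*-nonNeg (iverson-nonNeg (adj G x y)) (iverson-nonNeg (heavy θ y)))

  mass-nonNeg : ∀ k x → 0ℚ ≤ mass k x
  mass-nonNeg k x = *-nonNeg (sum-nonNeg {k} (λ j → ⊙-nonNeg leaf-nonNeg (power-nonNeg step-nonNeg (toℕ j)) x))
                             (*-nonNeg (ℕ→ℚ-nonNeg n) 0≤θ)

  relativeMass-nonNeg : ∀ k x → 0ℚ ≤ relativeMass k x
  relativeMass-nonNeg k x = *-nonNeg (mass-nonNeg k x) (inv-nonNeg (degℚ-nonNeg x))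

  mass-suc : ∀ k x → mass (suc k) x ≡ leaf x * nθ + heavyℚ x * ∑[ y < n ] (adjℚ x y * relativeMass k y)
  mass-suc k x = begin
    reachBefore (suc k) x * nθ
      ≡⟨ cong (_* nθ) (trans (reachBefore-suc k x) (cong (leaf x +_) (⊙-step (reachBefore k) x))) ⟩
    (leaf x + heavyℚ x * ∑[ y < n ] (adjℚ x y * (reachBefore k y * inv (degℚ y)))) * nθ
      ≡⟨ solve 4 (λ l h s m → (l :+ h :* s) :* m := l :* m :+ h :* (s :* m)) refl (leaf x) (heavyℚ x) _ nθ ⟩
    leaf x * nθ + heavyℚ x * (∑[ y < n ] (adjℚ x y * (reachBefore k y * inv (degℚ y))) * nθ)
      ≡⟨ cong (λ s → leaf x * nθ + heavyℚ x * s) (trans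
           (*-distribʳ-sum nθ (λ y → adjℚ x y * (reachBefore k y * inv (degℚ y))))
           (sum-cong-≗ (λ y → solve 4 (λ a r i m → a :* (r :* i) :* m := a :* (r :* m :* i))
              refl (adjℚ x y) (reachBefore k y) (inv (degℚ y)) nθ))) ⟩
    leaf x * nθ + heavyℚ x * ∑[ y < n ] (adjℚ x y * relativeMass k y) ∎
    where open ≡-Reasoning

  mass-light : ∀ k {x} → heavy θ x ≡ false → mass (suc k) x ≡ degℚ x
  mass-light k {x} light-x = begin
    mass (suc k) x                            ≡⟨ mass-suc k x ⟩
    leaf x * nθ + heavyℚ x * S                ≡⟨ cong₂ (λ l b → l + iverson b * S) (leaf-light light-x) light-x ⟩
    degℚ x + 0ℚ * S                           ≡⟨ solve 2 (λ d s → d :+ con 0ℚ :* s := d) refl (degℚ x) S ⟩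
    degℚ x                                    ∎
    where
    open ≡-Reasoning
    S = ∑[ y < n ] (adjℚ x y * relativeMass k y)

  relativeMass-light : ∀ k {x y} → adj G x y ≡ true → heavy θ y ≡ false → relativeMass (suc k) y ≡ 1ℚ
  relativeMass-light k {y = y} xy light-y = trans (cong (_* inv (degℚ y)) (mass-light k light-y)) (adjacent⇒degℚ*inv≡1 xy)

  mass-heavy : ∀ k {x} → heavy θ x ≡ true → mass (suc k) x ≡ ∑[ y < n ] (adjℚ x y * relativeMass k y)
  mass-heavy k {x} heavy-x = begin
    mass (suc k) x                            ≡⟨ mass-suc k x ⟩
    leaf x * nθ + heavyℚ x * S                ≡⟨ cong₂ (λ l b → l * nθ + iverson b * S) (leaf-heavy heavy-x) heavy-x ⟩
    0ℚ * nθ + 1ℚ * S                          ≡⟨ solve 2 (λ m s → con 0ℚ :* m :+ con 1ℚ :* s := s) refl nθ S ⟩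
    S                                         ∎
    where
    open ≡-Reasoning
    S = ∑[ y < n ] (adjℚ x y * relativeMass k y)

  mass-≤-degℚ : ∀ k x → mass k x ≤ degℚ x
  mass-≤-degℚ zero    x = subst (_≤ degℚ x) (sym (ℚP.*-zeroˡ nθ)) (degℚ-nonNeg x)
  mass-≤-degℚ (suc k) x = by-weight (heavy θ x) refl
    where
    term-≤ : ∀ y → adjℚ x y * relativeMass k y ≤ adjℚ x y
    term-≤ y = by-adjacency (adj G x y) refl
      where
      Z = relativeMass k y
      by-adjacency : ∀ b → adj G x y ≡ b → adjℚ x y * Z ≤ adjℚ x y
      by-adjacency false xy = subst (λ c → iverson c * Z ≤ iverson c) (sym xy) (ℚP.≤-reflexive (ℚP.*-zeroˡ Z))
      by-adjacency true  xy = subst (λ c → iverson c * Z ≤ iverson c) (sym xy)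
        (subst (_≤ 1ℚ) (sym (ℚP.*-identityˡ Z)) (subst (Z ≤_) (adjacent⇒degℚ*inv≡1 xy)
          (*-monoʳ-≤-nonNeg (inv (degℚ y)) (inv-nonNeg (degℚ-nonNeg y)) (mass-≤-degℚ k y))))
    by-weight : ∀ b → heavy θ x ≡ b → mass (suc k) x ≤ degℚ x
    by-weight false light-x = ℚP.≤-reflexive (mass-light k light-x)
    by-weight true  heavy-x = begin
      mass (suc k) x                                     ≡⟨ mass-heavy k heavy-x ⟩
      ∑[ y < n ] (adjℚ x y * relativeMass k y)   ≤⟨ sum-mono-≤ term-≤ ⟩
      ∑[ y < n ] adjℚ x y                                ≡⟨ degℚ≡∑adjℚ x ⟨
      degℚ x                                             ∎
      where open ℚP.≤-Reasoning

  relativeMass-≤-1 : ∀ k {x y} → adj G x y ≡ true → relativeMass k y ≤ 1ℚ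
  relativeMass-≤-1 k {y = y} xy = subst (relativeMass k y ≤_) (adjacent⇒degℚ*inv≡1 xy)
    (*-monoʳ-≤-nonNeg (inv (degℚ y)) (inv-nonNeg (degℚ-nonNeg y)) (mass-≤-degℚ k y))

  module LowerBound (α : ℕ) (U : Fin n → Fin n → ℚ)
           (U-nonNeg : ∀ x y → 0ℚ ≤ U x y)
           (U-rowSum : ∀ x → ∑[ y < n ] U x y ≤ ℕ→ℚ α)
           (U-covers : ∀ x y → adj G x y ≡ true → 1ℚ ≤ U x y ⊎ 1ℚ ≤ U y x) where

    a : ℚ
    a = ℕ→ℚ α * inv θ

    0≤a : 0ℚ ≤ a
    0≤a = *-nonNeg (ℕ→ℚ-nonNeg α) (inv-nonNeg 0≤θ)

    backward : Fin n → Fin n → ℚ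
    backward x y = inv θ * U y x

    backward-nonNeg : ∀ x y → 0ℚ ≤ backward x y
    backward-nonNeg x y = *-nonNeg (inv-nonNeg 0≤θ) (U-nonNeg y x)

    -- θ⁻ᵏ times the number of chains of k child-to-parent steps that end at x
    leak : ℕ → Fin n → ℚ
    leak k x = ∑[ z < n ] power backward k x z

    leak-nonNeg : ∀ k x → 0ℚ ≤ leak k x
    leak-nonNeg k x = sum-nonNeg (power-nonNeg backward-nonNeg k x)

    leak-zero : ∀ x → leak 0 x ≡ 1ℚ
    leak-zero x = trans (sum-cong-≗ (λ z → sym (ℚP.*-identityʳ (δF x z)))) (sum-δ* (λ _ → 1ℚ) x)

    θ*leak-suc : ∀ k x → θ * leak (suc k) x ≡ ∑[ y < n ] (U y x * leak k y)
    θ*leak-suc k x = begin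
      θ * leak (suc k) x                                  ≡⟨ cong (θ *_) (rowSum-⊗ backward (power backward k) x) ⟩
      θ * ∑[ y < n ] (inv θ * U y x * leak k y)           ≡⟨ *-distribˡ-sum θ (λ y → inv θ * U y x * leak k y) ⟩
      ∑[ y < n ] (θ * (inv θ * U y x * leak k y))         ≡⟨ sum-cong-≗ (λ y → solve 4 (λ t i u l → t :* (i :* u :* l) := t :* i :* (u :* l))
                                                               refl θ (inv θ) (U y x) (leak k y)) ⟩
      ∑[ y < n ] (θ * inv θ * (U y x * leak k y))         ≡⟨ sum-cong-≗ (λ y → trans (cong (_* (U y x * leak k y)) (inv-inverseʳ θ≢0))
                                                               (ℚP.*-identityˡ (U y x * leak k y))) ⟩
      ∑[ y < n ] (U y x * leak k y)                       ∎
      where open ≡-Reasoning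

    leak-≤ : ∀ k x → leak k x ≤ ℕ→ℚ n * a ^ k
    leak-≤ k x = ℚP.≤-trans (sum-mono-≤ (power-≤-^ backward-nonNeg 0≤a backward-colSum k x))
                            (ℚP.≤-reflexive (sum-const n (a ^ k)))
      where
      backward-colSum : ∀ z → ∑[ y < n ] backward y z ≤ a
      backward-colSum z = begin
        ∑[ y < n ] (inv θ * U z y)   ≡⟨ *-distribˡ-sum (inv θ) (U z) ⟨
        inv θ * ∑[ y < n ] U z y     ≤⟨ *-monoˡ-≤-nonNeg (inv θ) (inv-nonNeg 0≤θ) (U-rowSum z) ⟩
        inv θ * ℕ→ℚ α                ≡⟨ ℚP.*-comm (inv θ) (ℕ→ℚ α) ⟩
        a                            ∎
        where open ℚP.≤-Reasoning

    LowerBoundAt : ℕ → Set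
    LowerBoundAt k = ∀ {x} → heavy θ x ≡ true → degℚ x * (1ℚ - ℕ→ℚ k * a - leak k x) ≤ mass (suc k) x

    lowerBoundAt-zero : LowerBoundAt 0
    lowerBoundAt-zero {x} _ = begin
      degℚ x * (1ℚ - 0ℚ * a - leak 0 x) ≡⟨ cong (λ c → degℚ x * (1ℚ - 0ℚ * a - c)) (leak-zero x) ⟩
      degℚ x * (1ℚ - 0ℚ * a - 1ℚ)       ≡⟨ solve 2 (λ d a → d :* (con 1ℚ :- con 0ℚ :* a :- con 1ℚ) := con 0ℚ) refl (degℚ x) a ⟩
      0ℚ                                ≤⟨ mass-nonNeg 1 x ⟩
      mass 1 x                          ∎
      where open ℚP.≤-Reasoning

    lowerBound⇒relativeMass-≥ : ∀ k → LowerBoundAt k → ∀ {x y} → adj G x y ≡ true → heavy θ y ≡ true →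
      1ℚ - ℕ→ℚ k * a - leak k y ≤ relativeMass (suc k) y
    lowerBound⇒relativeMass-≥ k lower {y = y} xy heavy-y =
      *≤⇒≤*inv {degℚ y} (adjacent⇒degℚ*inv≡1 xy) (inv-nonNeg (degℚ-nonNeg y)) (lower heavy-y)

    neighbour-bound : ∀ k → LowerBoundAt k → ∀ {x y} → adj G x y ≡ true →
      1ℚ - ℕ→ℚ k * a ≤ relativeMass (suc k) y + U y x * leak k y + U x y
    neighbour-bound k lower {x} {y} xy = by-weight (heavy θ y) refl
      where
      L = ℕ→ℚ k * a
      C = leak k y
      0≤L : 0ℚ ≤ L
      0≤L = *-nonNeg (ℕ→ℚ-nonNeg k) 0≤a
      0≤UC : 0ℚ ≤ U y x * C
      0≤UC = *-nonNeg (U-nonNeg y x) (leak-nonNeg k y)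
      by-weight : ∀ b → heavy θ y ≡ b → 1ℚ - L ≤ relativeMass (suc k) y + U y x * C + U x y
      by-weight false light-y = begin
        1ℚ - L                                   ≤⟨ p-q≤p 0≤L ⟩
        1ℚ                                       ≡⟨ relativeMass-light k xy light-y ⟨
        relativeMass (suc k) y                   ≤⟨ ℚP.≤-trans (p≤p+q 0≤UC) (p≤p+q (U-nonNeg x y)) ⟩
        relativeMass (suc k) y + U y x * C + U x y ∎
        where open ℚP.≤-Reasoning
      by-weight true heavy-y = by-orientation (U-covers x y xy)
        where
        open ℚP.≤-Reasoning
        by-orientation : 1ℚ ≤ U x y ⊎ 1ℚ ≤ U y x → 1ℚ - L ≤ relativeMass (suc k) y + U y x * C + U x y
        by-orientation (inj₁ 1≤Uxy) = begin
          1ℚ - L                                     ≤⟨ p-q≤p 0≤L ⟩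
          1ℚ                                         ≤⟨ 1≤Uxy ⟩
          U x y                                      ≤⟨ p≤q+p (+-nonNeg (relativeMass-nonNeg (suc k) y) 0≤UC) ⟩
          relativeMass (suc k) y + U y x * C + U x y ∎
        by-orientation (inj₂ 1≤Uyx) = begin
          1ℚ - L                                     ≡⟨ solve 2 (λ l c → con 1ℚ :- l := (con 1ℚ :- l :- c) :+ c) refl L C ⟩
          (1ℚ - L - C) + C                           ≤⟨ ℚP.+-mono-≤ (lowerBound⇒relativeMass-≥ k lower xy heavy-y) C≤UC ⟩
          relativeMass (suc k) y + U y x * C         ≤⟨ p≤p+q (U-nonNeg x y) ⟩
          relativeMass (suc k) y + U y x * C + U x y ∎
          where
          C≤UC : C ≤ U y x * C
          C≤UC = subst (_≤ U y x * C) (ℚP.*-identityˡ C) (*-monoʳ-≤-nonNeg C (leak-nonNeg k y) 1≤Uyx)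

    edge-bound : ∀ k → LowerBoundAt k → ∀ x y →
      adjℚ x y * (1ℚ - ℕ→ℚ k * a) ≤ adjℚ x y * relativeMass (suc k) y + U y x * leak k y + U x y
    edge-bound k lower x y = by-adjacency (adj G x y) refl
      where
      R = U y x * leak k y + U x y
      0≤R : 0ℚ ≤ R
      0≤R = +-nonNeg (*-nonNeg (U-nonNeg y x) (leak-nonNeg k y)) (U-nonNeg x y)
      by-adjacency : ∀ b → adj G x y ≡ b →
        iverson b * (1ℚ - ℕ→ℚ k * a) ≤ iverson b * relativeMass (suc k) y + U y x * leak k y + U x y
      by-adjacency false _  = subst₂ _≤_ (sym (ℚP.*-zeroˡ (1ℚ - ℕ→ℚ k * a)))
        (solve 3 (λ z c u → c :+ u := con 0ℚ :* z :+ c :+ u) refl (relativeMass (suc k) y) (U y x * leak k y) (U x y)) 0≤R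
      by-adjacency true  xy = subst₂ (λ p q → p ≤ q + U y x * leak k y + U x y)
        (sym (ℚP.*-identityˡ (1ℚ - ℕ→ℚ k * a))) (sym (ℚP.*-identityˡ (relativeMass (suc k) y)))
        (neighbour-bound k lower xy)

    lowerBoundAt-suc : ∀ k → LowerBoundAt k → LowerBoundAt (suc k)
    lowerBoundAt-suc k lower {x} heavy-x = +-cancelʳ-≤ (d * leak (suc k) x + d * a) (begin
      d * (1ℚ - ℕ→ℚ (suc k) * a - leak (suc k) x) + (d * leak (suc k) x + d * a)
        ≡⟨ cong (λ K → d * (1ℚ - K * a - leak (suc k) x) + (d * leak (suc k) x + d * a)) (ℕ→ℚ-suc k) ⟩
      d * (1ℚ - (1ℚ + ℕ→ℚ k) * a - leak (suc k) x) + (d * leak (suc k) x + d * a)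
        ≡⟨ solve 4 (λ d K a c → d :* (con 1ℚ :- (con 1ℚ :+ K) :* a :- c) :+ (d :* c :+ d :* a) := d :* (con 1ℚ :- K :* a))
             refl d (ℕ→ℚ k) a (leak (suc k) x) ⟩
      d * (1ℚ - ℕ→ℚ k * a)
        ≡⟨ trans (cong (_* (1ℚ - ℕ→ℚ k * a)) (degℚ≡∑adjℚ x)) (*-distribʳ-sum (1ℚ - ℕ→ℚ k * a) (adjℚ x)) ⟩
      ∑[ y < n ] (adjℚ x y * (1ℚ - ℕ→ℚ k * a))
        ≤⟨ sum-mono-≤ (edge-bound k lower x) ⟩
      ∑[ y < n ] (adjℚ x y * relativeMass (suc k) y + U y x * leak k y + U x y)
        ≡⟨ trans (∑-distrib-+ (λ y → adjℚ x y * relativeMass (suc k) y + U y x * leak k y) (U x))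
                 (cong (_+ ∑[ y < n ] U x y) (∑-distrib-+ (λ y → adjℚ x y * relativeMass (suc k) y) (λ y → U y x * leak k y))) ⟩
      ∑[ y < n ] (adjℚ x y * relativeMass (suc k) y) + ∑[ y < n ] (U y x * leak k y) + ∑[ y < n ] U x y
        ≡⟨ cong₂ (λ p q → p + q + ∑[ y < n ] U x y) (sym (mass-heavy (suc k) heavy-x)) (sym (θ*leak-suc k x)) ⟩
      mass (suc (suc k)) x + θ * leak (suc k) x + ∑[ y < n ] U x y
        ≤⟨ ℚP.+-mono-≤ (ℚP.+-monoʳ-≤ (mass (suc (suc k)) x) (*-monoʳ-≤-nonNeg _ (leak-nonNeg (suc k) x) θ≤d)) ∑U≤d*a ⟩
      mass (suc (suc k)) x + d * leak (suc k) x + d * a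
        ≡⟨ ℚP.+-assoc (mass (suc (suc k)) x) _ _ ⟩
      mass (suc (suc k)) x + (d * leak (suc k) x + d * a) ∎)
      where
      open ℚP.≤-Reasoning
      d = degℚ x
      θ≤d : θ ≤ d
      θ≤d = ℚP.<⇒≤ (heavy⇒θ<degℚ heavy-x)
      ∑U≤d*a : ∑[ y < n ] U x y ≤ d * a
      ∑U≤d*a = ℚP.≤-trans (U-rowSum x) (subst (_≤ d * a) θ*a≡α (*-monoʳ-≤-nonNeg a 0≤a θ≤d))
        where
        θ*a≡α : θ * a ≡ ℕ→ℚ α
        θ*a≡α = trans (solve 3 (λ t α i → t :* (α :* i) := α :* (t :* i)) refl θ (ℕ→ℚ α) (inv θ))
                      (trans (cong (ℕ→ℚ α *_) (inv-inverseʳ θ≢0)) (ℚP.*-identityʳ (ℕ→ℚ α)))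

    mass-≥ : ∀ k → LowerBoundAt k
    mass-≥ zero    = lowerBoundAt-zero
    mass-≥ (suc k) = lowerBoundAt-suc k (mass-≥ k)

module _ {n : ℕ} (F : Fin n → Fin n → Bool) where

  Edge : Fin n → Fin n → Set
  Edge a b = F a b ≡ true

  module NonBacktrackingWalk (F-irrefl : ∀ v → F v v ≡ false) (s : ℕ → Fin n)
           (s-edge : ∀ k → Edge (s k) (s (suc k)))
           (s-nonBacktracking : ∀ k → s (suc (suc k)) ≢ s k) where

    trail : ℕ → ℕ → List (Fin n)
    trail i zero    = []
    trail i (suc L) = s i ∷ trail (suc i) L

    Distinct : ℕ → ℕ → Set
    Distinct i L = ∀ a b → i ℕ.≤ a → a ℕ.< b → b ℕ.< i ℕ.+ L → s a ≢ s b

    trail-length : ∀ i L → length (trail i L) ≡ L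
    trail-length i zero    = refl
    trail-length i (suc L) = cong suc (trail-length (suc i) L)

    trail-linked : ∀ i L → Linked Edge (trail i (suc L))
    trail-linked i zero    = [-]
    trail-linked i (suc L) = s-edge i ∷ trail-linked (suc i) L

    trail-∷ʳ : ∀ i L → trail i (suc L) ≡ trail i L ++ [ s (i ℕ.+ L) ]
    trail-∷ʳ i zero    = cong (λ j → [ s j ]) (sym (ℕP.+-identityʳ i))
    trail-∷ʳ i (suc L) = cong (s i ∷_) (trans (trail-∷ʳ (suc i) L) (cong (λ j → trail (suc i) L ++ [ s j ]) (sym (ℕP.+-suc i L))))

    trail-all : ∀ (P : Fin n → Set) i L → (∀ b → i ℕ.≤ b → b ℕ.< i ℕ.+ L → P (s b)) → All P (trail i L)
    trail-all P i zero    _  = []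
    trail-all P i (suc L) Ps = Ps i ℕP.≤-refl (ℕP.m<m+n i ℕ.z<s)
      ∷ trail-all P (suc i) L (λ b i<b b<i+1+L → Ps b (ℕP.<⇒≤ i<b) (subst (b ℕ.<_) (sym (ℕP.+-suc i L)) b<i+1+L))

    trail-unique : ∀ i L → Distinct i L → Unique (trail i L)
    trail-unique i zero    _        = []
    trail-unique i (suc L) distinct =
      trail-all (s i ≢_) (suc i) L (λ b i<b b<i+1+L → distinct i b ℕP.≤-refl i<b (subst (b ℕ.<_) (sym (ℕP.+-suc i L)) b<i+1+L))
      ∷ trail-unique (suc i) L (λ a b i<a a<b b<i+1+L → distinct a b (ℕP.<⇒≤ i<a) a<b (subst (b ℕ.<_) (sym (ℕP.+-suc i L)) b<i+1+L))

    closes-cycle : ∀ i L → 1 ℕ.≤ L → s i ≡ s (i ℕ.+ L) → Distinct i L → HasCycle F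
    closes-cycle i 1 _ si≡si+1 _ = contradiction
      (trans (sym (F-irrefl (s i))) (trans (cong (F (s i)) (trans si≡si+1 (cong s (ℕP.+-comm i 1)))) (s-edge i)))
      λ ()
    closes-cycle i 2 _ si≡si+2 _ = contradiction (sym (trans si≡si+2 (cong s (ℕP.+-comm i 2)))) (s-nonBacktracking i)
    closes-cycle i L@(suc (suc (suc _))) _ si≡si+L distinct =
      s i , trail (suc i) (ℕ.pred L) ,
      subst (2 ℕ.≤_) (sym (trail-length (suc i) (ℕ.pred L))) (ℕ.s≤s (ℕ.s≤s ℕ.z≤n)) ,
      trail-unique i L distinct ,
      subst (Linked Edge) (trans (trail-∷ʳ i L) (cong (λ x → trail i L ++ [ x ]) (sym si≡si+L))) (trail-linked i L)

    -- The first vertex repeating an earlier one closes a cycle with the segment in between.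
    distinct-prefix-or-cycle : ∀ m → Distinct 0 m ⊎ HasCycle F
    distinct-prefix-or-cycle zero    = inj₁ (λ _ _ _ _ ())
    distinct-prefix-or-cycle (suc m) with distinct-prefix-or-cycle m
    ... | inj₂ cycle    = inj₂ cycle
    ... | inj₁ distinct with FinP.any? (λ (i : Fin m) → s (toℕ i) FinP.≟ s m)
    ...   | yes (i , si≡sm) = inj₂ (closes-cycle (toℕ i) (m ℕ.∸ toℕ i) (ℕP.m<n⇒0<n∸m (FinP.toℕ<n i))
            (trans si≡sm (cong s (sym (ℕP.m+[n∸m]≡n (ℕP.<⇒≤ (FinP.toℕ<n i))))))
            (λ a b _ a<b b<i+[m∸i] → distinct a b ℕ.z≤n a<b
              (subst (b ℕ.<_) (ℕP.m+[n∸m]≡n (ℕP.<⇒≤ (FinP.toℕ<n i))) b<i+[m∸i])))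
    ...   | no no-repeat = inj₁ extended
      where
      extended : Distinct 0 (suc m)
      extended a b _ a<b b<1+m with ℕP.m≤n⇒m<n∨m≡n (ℕP.≤-pred b<1+m)
      ... | inj₁ b<m  = distinct a b ℕ.z≤n a<b b<m
      ... | inj₂ refl = λ sa≡sm → no-repeat (fromℕ< a<b , trans (cong s (FinP.toℕ-fromℕ< a<b)) sa≡sm)

    has-cycle : HasCycle F
    has-cycle with distinct-prefix-or-cycle (suc n)
    ... | inj₂ c        = c
    ... | inj₁ distinct with FinP.pigeonhole (ℕP.n<1+n n) (s ∘ toℕ)
    ...   | i , j , i<j , si≡sj = ⊥-elim (distinct (toℕ i) (toℕ j) ℕ.z≤n i<j (FinP.toℕ<n j) si≡sj)

  module _ (S : Subset n) where

    Nbr : Fin n → Fin n → Set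
    Nbr x y = y ∈ S × Edge x y

    nbr? : ∀ x y → Dec (Nbr x y)
    nbr? x y = (y SubsetP.∈? S) Dec.×-dec (F x y Bool.≟ true)

    Branching : Fin n → Set
    Branching x = ∃₂ λ y₁ y₂ → y₁ ≢ y₂ × Nbr x y₁ × Nbr x y₂

    branching? : ∀ x → Dec (Branching x)
    branching? x = FinP.any? λ y₁ → FinP.any? λ y₂ →
      Dec.¬? (y₁ FinP.≟ y₂) Dec.×-dec nbr? x y₁ Dec.×-dec nbr? x y₂

    branching⇒cycle : (∀ v → F v v ≡ false) → (∀ x → x ∈ S → Branching x) → ∀ {x₀} → x₀ ∈ S → HasCycle F
    branching⇒cycle F-irrefl branching {x₀} x₀∈S = NonBacktrackingWalk.has-cycle F-irrefl s s-edge s-nonBacktracking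
      where
      record Arc : Set where
        field
          tail head : Fin n
          head∈S    : head ∈ S
          edge      : Edge tail head
      open Arc

      onward : (prev cur : Fin n) → cur ∈ S → ∃ λ y → Nbr cur y × y ≢ prev
      onward prev cur cur∈S with branching cur cur∈S
      ... | y₁ , y₂ , y₁≢y₂ , nbr₁ , nbr₂ with y₁ FinP.≟ prev
      ...   | yes refl = y₂ , nbr₂ , y₁≢y₂ ∘ sym
      ...   | no y₁≢prev = y₁ , nbr₁ , y₁≢prev

      next : Arc → Arc
      next a = record { tail = head a ; head = proj₁ y ; head∈S = proj₁ (proj₁ (proj₂ y)) ; edge = proj₂ (proj₁ (proj₂ y)) }
        where y = onward (tail a) (head a) (head∈S a)

      arcs : ℕ → Arc
      arcs zero with branching x₀ x₀∈S
      ... | y , _ , _ , (y∈S , x₀y) , _ = record { tail = x₀ ; head = y ; head∈S = y∈S ; edge = x₀y }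
      arcs (suc k) = next (arcs k)

      s : ℕ → Fin n
      s k = tail (arcs k)

      s-edge : ∀ k → Edge (s k) (s (suc k))
      s-edge k = edge (arcs k)

      s-nonBacktracking : ∀ k → s (suc (suc k)) ≢ s k
      s-nonBacktracking k = proj₂ (proj₂ (onward (tail (arcs k)) (head (arcs k)) (head∈S (arcs k))))

    ∃-leaf : (∀ v → F v v ≡ false) → ¬ HasCycle F → ∀ {x₀} → x₀ ∈ S →
      ∃ λ x → x ∈ S × (∀ y₁ y₂ → Nbr x y₁ → Nbr x y₂ → y₁ ≡ y₂)
    ∃-leaf F-irrefl acyclic x₀∈S with FinP.any? (λ x → (x SubsetP.∈? S) Dec.×-dec Dec.¬? (branching? x))
    ... | yes (x , x∈S , ¬branching) = x , x∈S , at-most-one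
      where
      at-most-one : ∀ y₁ y₂ → Nbr x y₁ → Nbr x y₂ → y₁ ≡ y₂
      at-most-one y₁ y₂ nbr₁ nbr₂ with y₁ FinP.≟ y₂
      ... | yes y₁≡y₂ = y₁≡y₂
      ... | no y₁≢y₂  = contradiction (y₁ , y₂ , y₁≢y₂ , nbr₁ , nbr₂) ¬branching
    ... | no no-leaf = contradiction (branching⇒cycle F-irrefl all-branching x₀∈S) acyclic
      where
      all-branching : ∀ x → x ∈ S → Branching x
      all-branching x x∈S = Dec.decidable-stable (branching? x) (λ ¬branching → no-leaf (x , x∈S , ¬branching))

  module _ (F-sym : ∀ v w → F v w ≡ F w v) (F-irrefl : ∀ v → F v v ≡ false) (acyclic : ¬ HasCycle F) where

    Oriented : Subset n → (Fin n → Maybe (Fin n)) → Set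
    Oriented S p = ∀ a b → a ∈ S → b ∈ S → Edge a b → p a ≡ just b ⊎ p b ≡ just a

    attach-leaf : ∀ {S x} → x ∈ S → (∀ y₁ y₂ → Nbr S x y₁ → Nbr S x y₂ → y₁ ≡ y₂) →
      ∃ (Oriented (S Subset.- x)) → ∃ (Oriented S)
    attach-leaf {S} {x} x∈S at-most-one (q , q-oriented) = p , oriented
      where
      parent : Maybe (Fin n)
      parent with FinP.any? (nbr? S x)
      ... | yes (y , _) = just y
      ... | no _        = nothing

      parent-is : ∀ {y} → Nbr S x y → parent ≡ just y
      parent-is {y} nbr with FinP.any? (nbr? S x)
      ... | yes (y′ , nbr′) = cong just (at-most-one y′ y nbr′ nbr)
      ... | no none         = contradiction (y , nbr) none

      p : Fin n → Maybe (Fin n)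
      p z with z FinP.≟ x
      ... | yes _ = parent
      ... | no _  = q z

      p-x : p x ≡ parent
      p-x with x FinP.≟ x
      ... | yes _   = refl
      ... | no x≢x  = contradiction refl x≢x

      p-other : ∀ {z} → z ≢ x → p z ≡ q z
      p-other {z} z≢x with z FinP.≟ x
      ... | yes z≡x = contradiction z≡x z≢x
      ... | no _    = refl

      oriented : Oriented S p
      oriented a b a∈S b∈S ab = by-cases (a FinP.≟ x) (b FinP.≟ x)
        where
        by-cases : Dec (a ≡ x) → Dec (b ≡ x) → p a ≡ just b ⊎ p b ≡ just a
        by-cases (yes refl) _          = inj₁ (trans p-x (parent-is (b∈S , ab)))
        by-cases (no _)     (yes refl) = inj₂ (trans p-x (parent-is (a∈S , trans (F-sym b a) ab)))
        by-cases (no a≢x)   (no b≢x)   = Sum.map (trans (p-other a≢x)) (trans (p-other b≢x))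
          (q-oriented a b (SubsetP.x∈p∧x≢y⇒x∈p-y a∈S a≢x) (SubsetP.x∈p∧x≢y⇒x∈p-y b∈S b≢x) ab)

    -- Remove a vertex with at most one neighbour in S (one exists as F is acyclic) and make
    -- that neighbour its parent.
    orient-subset : ∀ fuel (S : Subset n) → ∣ S ∣ ℕ.< fuel → ∃ (Oriented S)
    orient-subset (suc fuel) S ∣S∣<1+fuel with SubsetP.nonempty? S
    ... | no empty = (λ _ → nothing) , λ a _ a∈S → contradiction (a , a∈S) empty
    ... | yes (x₀ , x₀∈S) with ∃-leaf S F-irrefl acyclic x₀∈S
    ...   | x , x∈S , at-most-one = attach-leaf x∈S at-most-one
            (orient-subset fuel (S Subset.- x) (ℕP.<-≤-trans (SubsetP.x∈p⇒∣p-x∣<∣p∣ x∈S) (ℕP.≤-pred ∣S∣<1+fuel)))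

    orientation : ∃ λ p → ∀ a b → Edge a b → p a ≡ just b ⊎ p b ≡ just a
    orientation with orient-subset (suc n) ⊤ (ℕ.s≤s (SubsetP.∣p∣≤n ⊤))
    ... | p , oriented = p , λ a b → oriented a b SubsetP.∈⊤ SubsetP.∈⊤

n≤2^⌈log2⌉ : ∀ n (rec : Acc ℕ._<_ n) → n ℕ.≤ 2 ℕ.^ ⌈log2⌉ n rec
n≤2^⌈log2⌉ zero          _         = ℕ.z≤n
n≤2^⌈log2⌉ (suc zero)    _         = ℕ.s≤s ℕ.z≤n
n≤2^⌈log2⌉ (suc (suc k)) (acc rec) = begin
  suc (suc k)                    ≡⟨ cong (λ m → suc (suc m)) (ℕP.⌊n/2⌋+⌈n/2⌉≡n k) ⟨
  suc (suc (⌊ k /2⌋ ℕ.+ ⌈ k /2⌉))  ≤⟨ ℕ.s≤s (ℕ.s≤s (ℕP.+-monoˡ-≤ ⌈ k /2⌉ (ℕP.⌊n/2⌋≤⌈n/2⌉ k))) ⟩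
  suc (suc (⌈ k /2⌉ ℕ.+ ⌈ k /2⌉))  ≡⟨ solve-2* ⌈ k /2⌉ ⟩
  2 ℕ.* suc ⌈ k /2⌉              ≤⟨ ℕP.*-monoʳ-≤ 2 (n≤2^⌈log2⌉ (suc ⌈ k /2⌉) _) ⟩
  2 ℕ.* 2 ℕ.^ ⌈log2⌉ (suc ⌈ k /2⌉) _ ∎
  where
  open ℕP.≤-Reasoning
  solve-2* : ∀ h → suc (suc (h ℕ.+ h)) ≡ 2 ℕ.* suc h
  solve-2* h = cong suc (trans (sym (ℕP.+-suc h h)) (cong (h ℕ.+_) (sym (ℕP.+-identityʳ (suc h)))))

n≤2^⌈log₂n⌉ : ∀ n → n ℕ.≤ 2 ℕ.^ ⌈log₂ n ⌉
n≤2^⌈log₂n⌉ n = n≤2^⌈log2⌉ n (<-wellFounded n)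

module ForestCover {n : ℕ} (G : Graph n) {α : ℕ} (arb : ArboricityAtMost G α) where

  forest : Fin α → Fin n → Fin n → Bool
  forest i = proj₁ (proj₁ arb i)

  forest-irrefl : ∀ i v → forest i v v ≡ false
  forest-irrefl i v = BoolP.¬-not (λ vv∈forest →
    contradiction (trans (sym (proj₂ (proj₂ (proj₁ arb i)) v v vv∈forest)) (irrefl G v)) λ ())

  parentIn : Fin α → Fin n → Maybe (Fin n)
  parentIn i = proj₁ (orientation (forest i) (proj₁ (proj₂ (proj₁ arb i))) (forest-irrefl i) (proj₁ (proj₂ arb) i))

  parentIn-covers : ∀ i a b → forest i a b ≡ true → parentIn i a ≡ just b ⊎ parentIn i b ≡ just a
  parentIn-covers i = proj₂ (orientation (forest i) (proj₁ (proj₂ (proj₁ arb i))) (forest-irrefl i) (proj₁ (proj₂ arb) i))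

  parentCount : Fin n → Fin n → ℚ
  parentCount x y = ∑[ i < α ] δjust y (parentIn i x)

  parentCount-nonNeg : ∀ x y → 0ℚ ≤ parentCount x y
  parentCount-nonNeg x y = sum-nonNeg (λ i → δ-nonNeg (MaybeP.≡-dec FinP._≟_) (parentIn i x) (just y))

  parentCount-rowSum : ∀ x → ∑[ y < n ] parentCount x y ≤ ℕ→ℚ α
  parentCount-rowSum x = begin
    ∑[ y < n ] ∑[ i < α ] δjust y (parentIn i x)  ≡⟨ ∑-comm (λ y i → δjust y (parentIn i x)) ⟩
    ∑[ i < α ] ∑[ y < n ] δjust y (parentIn i x)  ≤⟨ sum-mono-≤ (λ i → ∑δjust≤1 (parentIn i x)) ⟩
    ∑[ i < α ] 1ℚ                                 ≡⟨ sum-const α 1ℚ ⟩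
    ℕ→ℚ α * 1ℚ                                    ≡⟨ ℚP.*-identityʳ (ℕ→ℚ α) ⟩
    ℕ→ℚ α                                         ∎
    where open ℚP.≤-Reasoning

  1≤parentCount : ∀ i {x y} → parentIn i x ≡ just y → 1ℚ ≤ parentCount x y
  1≤parentCount i {x} {y} px≡y = subst (_≤ parentCount x y)
    (trans (cong (δjust y) px≡y) (trans (δjust-just y y) (δ-refl FinP._≟_ y)))
    (term-≤-sum (λ i → δ-nonNeg (MaybeP.≡-dec FinP._≟_) (parentIn i x) (just y)) i)

  parentCount-covers : ∀ x y → adj G x y ≡ true → 1ℚ ≤ parentCount x y ⊎ 1ℚ ≤ parentCount y x
  parentCount-covers x y xy with proj₂ (proj₂ arb) x y xy
  ... | i , xy∈forest = Sum.map (1≤parentCount i) (1≤parentCount i) (parentIn-covers i x y xy∈forest)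

edge⇒distinct : ∀ {n} (G : Graph n) {v w} → IsEdge G v w → v ≢ w
edge⇒distinct G {v} vw refl = contradiction (trans (sym (irrefl G v)) vw) λ ()

distinct⇒2≤n : ∀ {n} {v w : Fin n} → v ≢ w → 2 ℕ.≤ n
distinct⇒2≤n {suc zero}    {zero} {zero} v≢w = contradiction refl v≢w
distinct⇒2≤n {suc (suc _)} _                 = ℕ.s≤s (ℕ.s≤s ℕ.z≤n)

1≤exponent : ∀ {N k} → 2 ℕ.≤ N → N ℕ.≤ 2 ℕ.^ k → 1 ℕ.≤ k
1≤exponent {k = zero}  2≤N N≤1 = contradiction (ℕP.≤-trans 2≤N N≤1) λ { (ℕ.s≤s ()) }
1≤exponent {k = suc _} _   _   = ℕ.s≤s ℕ.z≤n

2≤exponent : ∀ {N k} → 4 ℕ.* k ℕ.< N → N ℕ.≤ 2 ℕ.^ k → 1 ℕ.≤ k → 2 ℕ.≤ k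
2≤exponent {k = 1}           4<N N≤2 _ = contradiction (ℕP.<-≤-trans 4<N N≤2) λ { (ℕ.s≤s (ℕ.s≤s ())) }
2≤exponent {k = suc (suc _)} _   _   _ = ℕ.s≤s (ℕ.s≤s ℕ.z≤n)

deg≤n : ∀ {n} (G : Graph n) v → deg G v ℕ.≤ n
deg≤n {n} G v = ℕP.≤-trans (ListP.length-filter (λ w → adj G v w Bool.≟ true) (allFin n))
                           (ℕP.≤-reflexive (ListP.length-tabulate {n = n} (λ w → w)))

module Analysis {n : ℕ} (G : Graph n) (α : ℕ) (ε : ℚ) (0<ε : 0ℚ < ε) (ε<1 : ε < 1ℚ)
                (arb : ArboricityAtMost G α) {v w : Fin n} (vw : IsEdge G v w) where
  open Procedures G using (θ-of; ℓ-of; heavy)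
  open SampleEdge G α ε
  open ForestCover G arb

  θ : ℚ
  θ = θ-of α ε

  ℓ : ℕ
  ℓ = ℓ-of

  wv : IsEdge G w v
  wv = trans (symm G w v) vw

  2≤n : 2 ℕ.≤ n
  2≤n = distinct⇒2≤n (edge⇒distinct G vw)

  n≤2^ℓ : n ℕ.≤ 2 ℕ.^ ℓ
  n≤2^ℓ = n≤2^⌈log₂n⌉ n

  1≤ℓ : 1 ℕ.≤ ℓ
  1≤ℓ = 1≤exponent 2≤n n≤2^ℓ

  1≤α : 1 ℕ.≤ α
  1≤α with proj₂ (proj₂ arb) v w vw
  ... | i , _ = ℕP.≤-trans (ℕ.s≤s ℕ.z≤n) (FinP.toℕ<n i)

  4αℓ : ℚ
  4αℓ = ℕ→ℚ (4 ℕ.* α ℕ.* ℓ)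

  4ℓ≤4αℓ : 4 ℕ.* ℓ ℕ.≤ 4 ℕ.* α ℕ.* ℓ
  4ℓ≤4αℓ = ℕP.*-monoˡ-≤ ℓ (ℕP.*-monoʳ-≤ 4 1≤α)

  0<4αℓ : 0ℚ < 4αℓ
  0<4αℓ = ℚP.<-≤-trans (ℕ→ℚ-suc-pos 0) (ℕ→ℚ-mono-≤ (ℕP.≤-trans (ℕP.*-mono-≤ {1} {4} (ℕ.s≤s ℕ.z≤n) 1≤ℓ) 4ℓ≤4αℓ))

  θ*ε≡4αℓ : θ * ε ≡ 4αℓ
  θ*ε≡4αℓ = begin
    θ * ε              ≡⟨ cong (_* ε) (÷₀≡*inv 4αℓ ε) ⟩
    4αℓ * inv ε * ε    ≡⟨ solve 3 (λ k i e → k :* i :* e := k :* (e :* i)) refl 4αℓ (inv ε) ε ⟩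
    4αℓ * (ε * inv ε)  ≡⟨ cong (4αℓ *_) (inv-inverseʳ (ℚP.<⇒≢ 0<ε ∘ sym)) ⟩
    4αℓ * 1ℚ           ≡⟨ ℚP.*-identityʳ 4αℓ ⟩
    4αℓ                ∎
    where open ≡-Reasoning

  4αℓ≤θ : 4αℓ ≤ θ
  4αℓ≤θ = subst₂ _≤_ θ*ε≡4αℓ (ℚP.*-identityʳ θ) (*-monoˡ-≤-nonNeg θ 0≤θ (ℚP.<⇒≤ ε<1))
    where
    0≤θ : 0ℚ ≤ θ
    0≤θ = subst (0ℚ ≤_) (sym (÷₀≡*inv 4αℓ ε)) (*-nonNeg (ℚP.<⇒≤ 0<4αℓ) (inv-nonNeg (ℚP.<⇒≤ 0<ε)))

  0<θ : 0ℚ < θ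
  0<θ = ℚP.<-≤-trans 0<4αℓ 4αℓ≤θ

  0<n : 0ℚ < ℕ→ℚ n
  0<n = ℚP.<-≤-trans (ℕ→ℚ-suc-pos 0) (ℕ→ℚ-mono-≤ (ℕP.≤-trans (ℕ.s≤s ℕ.z≤n) 2≤n))

  open Bounds G θ 0<θ (ℚP.<⇒≢ 0<n ∘ sym)
  open LowerBound α parentCount parentCount-nonNeg parentCount-rowSum parentCount-covers

  4*ℓa≡ε : ℕ→ℚ 4 * (ℕ→ℚ ℓ * a) ≡ ε
  4*ℓa≡ε = begin
    ℕ→ℚ 4 * (ℕ→ℚ ℓ * (ℕ→ℚ α * inv θ))  ≡⟨ solve 4 (λ f l a i → f :* (l :* (a :* i)) := f :* a :* l :* i) refl (ℕ→ℚ 4) (ℕ→ℚ ℓ) (ℕ→ℚ α) (inv θ) ⟩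
    ℕ→ℚ 4 * ℕ→ℚ α * ℕ→ℚ ℓ * inv θ      ≡⟨ cong (_* inv θ) (trans (ℕ→ℚ-* (4 ℕ.* α) ℓ) (cong (_* ℕ→ℚ ℓ) (ℕ→ℚ-* 4 α))) ⟨
    4αℓ * inv θ                        ≡⟨ cong (_* inv θ) θ*ε≡4αℓ ⟨
    θ * ε * inv θ                      ≡⟨ solve 3 (λ t e i → t :* e :* i := e :* (t :* i)) refl θ ε (inv θ) ⟩
    ε * (θ * inv θ)                    ≡⟨ cong (ε *_) (inv-inverseʳ θ≢0) ⟩
    ε * 1ℚ                             ≡⟨ ℚP.*-identityʳ ε ⟩
    ε                                  ∎
    where open ≡-Reasoning

  ℓa≤1 : ℕ→ℚ ℓ * a ≤ 1ℚ
  ℓa≤1 = begin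
    ℓa                ≤⟨ p≤p+q (*-nonNeg (ℕ→ℚ-nonNeg 3) (*-nonNeg (ℕ→ℚ-nonNeg ℓ) 0≤a)) ⟩
    ℓa + ℕ→ℚ 3 * ℓa   ≡⟨ solve 1 (λ x → x :+ con (ℕ→ℚ 3) :* x := con (ℕ→ℚ 4) :* x) refl ℓa ⟩
    ℕ→ℚ 4 * ℓa        ≡⟨ 4*ℓa≡ε ⟩
    ε                 ≤⟨ ℚP.<⇒≤ ε<1 ⟩
    1ℚ                ∎
    where
    open ℚP.≤-Reasoning
    ℓa = ℕ→ℚ ℓ * a

  relativeMass≤1 : relativeMass (suc ℓ) v ≤ 1ℚ
  relativeMass≤1 = relativeMass-≤-1 (suc ℓ) wv

  1-ε/2≤relativeMass : 1ℚ - ½ * ε ≤ relativeMass (suc ℓ) v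
  1-ε/2≤relativeMass = by-weight (heavy θ v) refl
    where
    by-weight : ∀ b → heavy θ v ≡ b → 1ℚ - ½ * ε ≤ relativeMass (suc ℓ) v
    by-weight false light-v = subst (1ℚ - ½ * ε ≤_) (sym (relativeMass-light ℓ wv light-v))
      (p-q≤p (*-nonNeg (ℚP.nonNegative⁻¹ ½) (ℚP.<⇒≤ 0<ε)))
    by-weight true heavy-v = begin
      1ℚ - ½ * ε              ≡⟨ cong (λ e → 1ℚ - ½ * e) 4*ℓa≡ε ⟨
      1ℚ - ½ * (ℕ→ℚ 4 * ℓa)   ≡⟨ solve 1 (λ x → con 1ℚ :- con ½ :* (con (ℕ→ℚ 4) :* x) := con 1ℚ :- x :- x) refl ℓa ⟩
      1ℚ - ℓa - ℓa            ≤⟨ ℚP.+-monoʳ-≤ (1ℚ - ℓa) (ℚP.neg-antimono-≤ leak≤ℓa) ⟩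
      1ℚ - ℓa - leak ℓ v      ≤⟨ lowerBound⇒relativeMass-≥ ℓ (mass-≥ ℓ) wv heavy-v ⟩
      relativeMass (suc ℓ) v  ∎
      where
      open ℚP.≤-Reasoning
      ℓa = ℕ→ℚ ℓ * a
      4ℓ<n : 4 ℕ.* ℓ ℕ.< n
      4ℓ<n = ℕ→ℚ-cancel-< (ℚP.≤-<-trans (ℚP.≤-trans (ℕ→ℚ-mono-≤ 4ℓ≤4αℓ) 4αℓ≤θ)
                            (ℚP.<-≤-trans (heavy⇒θ<degℚ heavy-v) (ℕ→ℚ-mono-≤ (deg≤n G v))))
      leak≤ℓa : leak ℓ v ≤ ℓa
      leak≤ℓa = ℚP.≤-trans (leak-≤ ℓ v) (N*a^ℓ≤ℓ*a 0≤a n≤2^ℓ (2≤exponent 4ℓ<n n≤2^ℓ 1≤ℓ) ℓa≤1)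

  D : ℚ
  D = ℕ→ℚ n * θ * ℕ→ℚ (suc ℓ)

  0<D : 0ℚ < D
  0<D = *-pos (*-pos 0<n 0<θ) (ℕ→ℚ-suc-pos ℓ)

  PrSampleEdge≡relativeMass/D : PrSampleEdge G α ε v w ≡ relativeMass (suc ℓ) v * inv D
  PrSampleEdge≡relativeMass/D = begin
    P                        ≡⟨ ℚP.*-identityʳ P ⟨
    P * 1ℚ                   ≡⟨ cong (P *_) (inv-inverseʳ (ℚP.<⇒≢ 0<D ∘ sym)) ⟨
    P * (D * inv D)          ≡⟨ ℚP.*-assoc P D (inv D) ⟨
    P * D * inv D            ≡⟨ cong (λ p → p * D * inv D) (PrSampleEdge≡ vw) ⟩
    inv L * (reachBefore (suc ℓ) v * inv (degℚ v)) * (nθ * L) * inv D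
      ≡⟨ cong (_* inv D) (solve 5 (λ j r i m l → j :* (r :* i) :* (m :* l) := r :* m :* i :* (l :* j))
           refl (inv L) (reachBefore (suc ℓ) v) (inv (degℚ v)) nθ L) ⟩
    relativeMass (suc ℓ) v * (L * inv L) * inv D
      ≡⟨ cong (λ x → relativeMass (suc ℓ) v * x * inv D) (inv-inverseʳ (ℚP.<⇒≢ (ℕ→ℚ-suc-pos ℓ) ∘ sym)) ⟩
    relativeMass (suc ℓ) v * 1ℚ * inv D
      ≡⟨ cong (_* inv D) (ℚP.*-identityʳ (relativeMass (suc ℓ) v)) ⟩
    relativeMass (suc ℓ) v * inv D   ∎
    where
    open ≡-Reasoning
    P = PrSampleEdge G α ε v w
    L = ℕ→ℚ (suc ℓ)

corollary2p9 : (n : ℕ) (G : Graph n) (α : ℕ) (ε : ℚ) →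
    0ℚ < ε → ε < 1ℚ → ArboricityAtMost G α →
    (v w : Fin n) → IsEdge G v w →
    ((1ℚ - ½ * ε) ÷₀ (ℕ→ℚ n * Procedures.θ-of G α ε * ℕ→ℚ (suc (Procedures.ℓ-of G)))
    ≤ PrSampleEdge G α ε v w)
    × (PrSampleEdge G α ε v w
    ≤ 1ℚ ÷₀ (ℕ→ℚ n * Procedures.θ-of G α ε * ℕ→ℚ (suc (Procedures.ℓ-of G))))
corollary2p9 n G α ε 0<ε ε<1 arb v w vw =
  ÷₀-sandwich (ℚP.<⇒≤ 0<D) PrSampleEdge≡relativeMass/D 1-ε/2≤relativeMass relativeMass≤1
  where open Analysis G α ε 0<ε ε<1 arb vw
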